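{- Let $k$ be a field of characteristic zero, $H$ the matroid Hopf algebra over $k$, $K=k[x,y,s]$, and $$\alpha(x,y,s,\cdot)=\exp_\ast\big(s\{\delta_{\mathrm{coloop}}+(y-1)\delta_{\mathrm{loop}}\}\big)\ast\exp_\ast\big(s\{(x-1)\delta_{\mathrm{coloop}}+\delta_{\mathrm{loop}}\}\big):H\to K.$$ Then for every matroid $M=(E,\mathcal I)$, $$\alpha(x,y,s,M)=s^{|E|}\,T_M(x,y).$$
   Context: Matroids $M=(E,\mathcal I)$ on finite ground sets; rank $r(A)=\max\{|B|:B\in\mathcal I,B\subseteq A\}$. Tutte polynomial: $T_M(x,y)=\sum_{A\subseteq E}(x-1)^{r(E)-r(A)}(y-1)^{|A|-r(A)}$. Deletion $M\backslash T$: matroid on $E-T$ with independent sets $\{I\in\mathcal I:I\subseteq E-T\}$; restriction $M|_A=M\backslash(E-A)$; dual $M^\star$: bases are complements of bases; contraction $M/T=(M^\star\backslash T)^\star$. $U_{r,n}$: uniform matroid on $n$ elements with independent sets the subsets of size $\le r$. The matroid Hopf algebra $H$ over $k$ has basis the isomorphism classes of matroids, product induced by direct sum, unit the empty matroid $\mathbf 1$, coproduct $\Delta(M)=\sum_{A\subseteq E}M|_A\otimes M/A$, counit $\epsilon(M)=1$ if $E=\emptyset$, else $0$. For linear $f,g:H\to K$, $(f\ast g)(M)=\sum_{A\subseteq E}f(M|_A)g(M/A)$. For linear $\delta:H\to K$ with $\delta(\mathbf 1)=0$, $\exp_\ast(\delta)=\sum_{k\ge 0}\delta^{\ast k}/k!$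 with $\delta^{\ast 0}=\epsilon$. $\delta_{\mathrm{loop}}(M)=1$ if $M\cong U_{0,1}$, else $0$; $\delta_{\mathrm{coloop}}(M)=1$ if $M\cong U_{1,1}$, else $0$. -}

module Defs where

open import Level using (Level) renaming (suc to lsuc; _⊔_ to _⊔ˡ_)
open import Data.Bool using (Bool; true; false; _∧_; _∨_; not; if_then_else_)
open import Data.Nat using (ℕ; zero; suc; _∸_; _<_; _⊔_; _!; _≡ᵇ_; NonZero)
  renaming (_+_ to _+ℕ_)
open import Data.Nat.Properties using (_!≢0)
open import Data.Fin using (Fin)
open import Data.Fin.Subset using (Subset; inside; outside; _∈_; _∉_; _⊆_; _∪_; _∩_; _─_; ∁; ⁅_⁆; ∣_∣)
  renaming (⊥ to ∅)
open import Data.Vec using (Vec; []; _∷_; zipWith)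
open import Data.List using (upTo; List; []; _∷_; _++_; map; foldr; filterᵇ)
open import Data.Bool.ListAction using (any; all)
open import Data.Product using (_×_; ∃-syntax)
open import Relation.Nullary using (¬_)
open import Relation.Binary.PropositionalEquality using (_≡_)
open import Algebra.Bundles using (CommutativeRing)

record Field (c ℓ : Level) : Set (lsuc (c ⊔ˡ ℓ)) where
  field
    commutativeRing : CommutativeRing c ℓ
  open CommutativeRing commutativeRing
  field
    1≉0        : ¬ (1# ≈ 0#)
    inv        : (x : Carrier) → ¬ (x ≈ 0#) → Carrier
    inv-inverse : ∀ x (x≉0 : ¬ (x ≈ 0#)) → x * inv x x≉0 ≈ 1#

module FieldOps {c ℓ} (F : Field c ℓ) where
  open Field F public using (commutativeRing; inv; inv-inverse; 1≉0)
  open CommutativeRing commutativeRing public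
    using (Carrier; _≈_; _+_; _*_; -_; 0#; 1#)

  natK : ℕ → Carrier
  natK zero    = 0#
  natK (suc n) = 1# + natK n

CharZero : ∀ {c ℓ} → Field c ℓ → Set ℓ
CharZero F = ∀ n → ¬ (natK (suc n) ≈ 0#)
  where open FieldOps F

-- The polynomial ring K = k[x,y,s], represented by coefficient functions
-- (coefficient of x^a y^b s^c), with equality coefficientwise.

module PolyRing {c ℓ} (F : Field c ℓ) where
  open FieldOps F

  Pol : Set c
  Pol = ℕ → ℕ → ℕ → Carrier

  infix 4 _≈P_
  _≈P_ : Pol → Pol → Set ℓ
  p ≈P q = ∀ a b d → p a b d ≈ q a b d

  sumTo : (ℕ → Carrier) → ℕ → Carrier
  sumTo f zero    = f zero
  sumTo f (suc a) = f (suc a) + sumTo f a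

  constP : Carrier → Pol
  constP r zero zero zero = r
  constP r _    _    _    = 0#

  0P 1P : Pol
  0P = constP 0#
  1P = constP 1#

  infixl 6 _+P_ _-P_
  infixl 7 _*P_
  infixr 8 _^P_

  _+P_ : Pol → Pol → Pol
  (p +P q) a b d = p a b d + q a b d

  -P_ : Pol → Pol
  (-P p) a b d = - (p a b d)

  _-P_ : Pol → Pol → Pol
  p -P q = p +P (-P q)

  _*P_ : Pol → Pol → Pol
  (p *P q) a b d =
    sumTo (λ i → sumTo (λ j → sumTo (λ l →
      p i j l * q (a ∸ i) (b ∸ j) (d ∸ l)) d) b) a

  _^P_ : Pol → ℕ → Pol
  p ^P zero  = 1P
  p ^P suc n = p *P (p ^P n)

  mono : ℕ → ℕ → ℕ → Pol
  mono i j l a b d = if (i ≡ᵇ a) ∧ (j ≡ᵇ b) ∧ (l ≡ᵇ d) then 1# else 0#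

  X Y S : Pol
  X = mono 1 0 0
  Y = mono 0 1 0
  S = mono 0 0 1

  ΣP : List Pol → Pol
  ΣP = foldr _+P_ 0P

subsets : (n : ℕ) → List (Subset n)
subsets zero    = [] ∷ []
subsets (suc n) = map (outside ∷_) (subsets n) ++ map (inside ∷_) (subsets n)

_⊆ᵇ_ : ∀ {n} → Subset n → Subset n → Bool
[]          ⊆ᵇ []          = true
(outside ∷ p) ⊆ᵇ (_ ∷ q)   = p ⊆ᵇ q
(inside ∷ p)  ⊆ᵇ (b ∷ q)   = b ∧ (p ⊆ᵇ q)

-- Matroids on a ground set E ⊆ Fin n, given by their independent sets.
-- RawMatroid carries the data; IsMatroid the matroid axioms.

record RawMatroid : Set where
  constructor rawMatroid
  field
    size  : ℕ
    E     : Subset size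
    indep : Subset size → Bool

record IsMatroid (M : RawMatroid) : Set where
  open RawMatroid M
  field
    indep⊆E    : ∀ I → indep I ≡ true → I ⊆ E
    indep-∅    : indep ∅ ≡ true
    hereditary : ∀ I J → J ⊆ I → indep I ≡ true → indep J ≡ true
    augment    : ∀ I J → indep I ≡ true → indep J ≡ true → ∣ I ∣ < ∣ J ∣ →
                 ∃[ e ] (e ∈ J × e ∉ I × indep (I ∪ ⁅ e ⁆) ≡ true)

record Matroid : Set where
  field
    raw       : RawMatroid
    isMatroid : IsMatroid raw
  open RawMatroid raw public

module _ (M : RawMatroid) where
  open RawMatroid M

  rank : Subset size → ℕ
  rank A = foldr _⊔_ 0
    (map ∣_∣ (filterᵇ (λ B → indep B ∧ (B ⊆ᵇ A)) (subsets size)))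

  isBasis : Subset size → Bool
  isBasis B = indep B ∧ all (λ C → not (indep C ∧ (B ⊆ᵇ C) ∧ not (C ⊆ᵇ B)))
                            (subsets size)

-- dual: bases are complements (in E) of bases; independent = contained in a basis
dual : RawMatroid → RawMatroid
dual M = rawMatroid size E
  (λ I → (I ⊆ᵇ E) ∧ any (λ B → isBasis M B ∧ (I ⊆ᵇ (E ─ B))) (subsets size))
  where open RawMatroid M

delete : (M : RawMatroid) → Subset (RawMatroid.size M) → RawMatroid
delete M T = rawMatroid size (E ─ T) (λ I → indep I ∧ (I ⊆ᵇ (E ─ T)))
  where open RawMatroid M

restrict : (M : RawMatroid) → Subset (RawMatroid.size M) → RawMatroid
restrict M A = delete M (RawMatroid.E M ─ A)

contract : (M : RawMatroid) → Subset (RawMatroid.size M) → RawMatroid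
contract M T = dual (delete (dual M) T)

isLoopMatroid : RawMatroid → Bool
isLoopMatroid M = (∣ E ∣ ≡ᵇ 1) ∧ not (indep E)
  where open RawMatroid M

isColoopMatroid : RawMatroid → Bool
isColoopMatroid M = (∣ E ∣ ≡ᵇ 1) ∧ indep E
  where open RawMatroid M

-- Linear maps H → K (determined by their values on matroids),
-- convolution, exp_*, and the Tutte polynomial.

module Convolution {c ℓ} (F : Field c ℓ) (char0 : CharZero F) where
  open FieldOps F
  open PolyRing F

  Fun : Set c
  Fun = RawMatroid → Pol

  sumSubsets : (M : RawMatroid) → (Subset (RawMatroid.size M) → Pol) → Pol
  sumSubsets M g = ΣP (map g (filterᵇ (λ A → A ⊆ᵇ RawMatroid.E M) (subsets (RawMatroid.size M))))

  infixl 7 _⋆_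
  _⋆_ : Fun → Fun → Fun
  (f ⋆ g) M = sumSubsets M (λ A → f (restrict M A) *P g (contract M A))

  ε : Fun
  ε M = if ∣ RawMatroid.E M ∣ ≡ᵇ 0 then 1P else 0P

  _+F_ : Fun → Fun → Fun
  (f +F g) M = f M +P g M

  _·F_ : Pol → Fun → Fun
  (p ·F f) M = p *P f M

  _^⋆_ : Fun → ℕ → Fun
  f ^⋆ zero  = ε
  f ^⋆ suc n = f ⋆ (f ^⋆ n)

  δloop δcoloop : Fun
  δloop   M = if isLoopMatroid M then 1P else 0P
  δcoloop M = if isColoopMatroid M then 1P else 0P

  natK≉0 : (m : ℕ) → .{{NonZero m}} → ¬ (natK m ≈ 0#)
  natK≉0 (suc m) = char0 m

  invFact : ℕ → Carrier
  invFact j = inv (natK (j !)) (natK≉0 (j !) {{j !≢0}})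

  -- exp_*(δ)(M) = Σ_j δ^{*j}(M) / j!; the terms with j > |E| vanish
  -- (δ(1) = 0), so the sum is taken over 0 ≤ j ≤ |E|.
  exp⋆ : Fun → Fun
  exp⋆ δ M = ΣP (map (λ j → constP (invFact j) *P (δ ^⋆ j) M)
                      (upTo (suc ∣ RawMatroid.E M ∣)))

  α : Fun
  α = exp⋆ (S ·F (δcoloop +F ((Y -P 1P) ·F δloop)))
    ⋆ exp⋆ (S ·F (((X -P 1P) ·F δcoloop) +F δloop))

  Tutte : RawMatroid → Pol
  Tutte M = sumSubsets M (λ A →
      ((X -P 1P) ^P (rank M E ∸ rank M A)) *P ((Y -P 1P) ^P (∣ A ∣ ∸ rank M A)))
    where open RawMatroid M

-- Idea. Both characters exponentiated in α vanish except on one-element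
-- matroids: the first takes the value s on a coloop and s(y-1) on a loop, the
-- second s(x-1) and s. For such a character δ with values a (coloop) and b
-- (loop), a nonzero term of δ^{*k}(N) peels the points of N off one at a time,
-- each a coloop (raising the rank) or a loop; so δ^{*k}(N) = [k = |E|] k! a^r b^{|E|-r}
-- with r = r(N), and exp_*(δ)(N) = a^r b^{|E|-r}. The summand of α(M) at A ⊆ E is
-- then s^{r(A)} (s(y-1))^{|A|-r(A)} · (s(x-1))^{r(M/A)} s^{|E-A|-r(M/A)}, which is
-- s^{|E|} (x-1)^{r(E)-r(A)} (y-1)^{|A|-r(A)} because r(M/A) = r(E) - r(A).
module Submission where

open import Defs
open import Level using (Level)
open import Data.Fin.Subset using (∣_∣)

open import Function using (_∘_)
open import Function.Bundles using (Equivalence)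
open import Data.Empty using (⊥)
open import Data.Product using (_×_; _,_; ∃-syntax; proj₁; proj₂)
open import Data.Sum using ([_,_]′; inj₁; inj₂)
open import Relation.Nullary using (¬_; yes; no; contradiction)
open import Relation.Nullary.Decidable using (T?)
open import Relation.Binary.PropositionalEquality as ≡ using (_≡_)
open import Relation.Binary.Structures using (IsEquivalence)
open import Data.Bool using (Bool; true; false; T; _∧_; not; if_then_else_)
open import Data.Bool.Properties using (∧-conicalˡ; ∧-conicalʳ; T-≡)
open import Data.Bool.ListAction using (all; any)
open import Data.Nat using (ℕ; zero; suc; _∸_; _≤_; z≤n; s≤s)
open import Data.Nat.Properties using (≤-refl; ≤-trans; ≤-reflexive; m≤n⇒m≤1+n; n∸n≡0; +-∸-assoc)
open import Data.Fin using (Fin; zero; suc)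
open import Data.Vec using ([]; _∷_; here; there)
open import Data.Fin.Subset using (Subset; inside; outside; _∈_; _∉_; _⊆_; _∪_; _∩_; _─_; ⁅_⁆)
  renaming (⊥ to ∅)
open import Data.Fin.Subset.Properties
  using (_∈?_; drop-there; drop-∷-⊆; x∈p∪q⁻; x∈⁅y⁆⇒x≡y; ∣p∣≤∣x∷p∣; ∪-identityʳ; p⊂q⇒∣p∣<∣q∣;
         p⊆q⇒∣p∣≤∣q∣; ⊆-refl; ⊆-trans; ⊥⊆; ∣⊥∣≡0; p─q⊆p; p⊆p∪q; q⊆p∪q;
         x∈p∩q⁺; x∈p∩q⁻; ∣p∩q∣≤∣q∣; x∈p∧x∉q⇒x∈p─q)
open import Data.List using ([]; _∷_; map; foldr; filterᵇ)
open import Data.List.Properties using (map-∘)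
open import Data.List.Membership.Propositional using () renaming (_∈_ to _∈L_)
open import Data.List.Membership.Propositional.Properties
  using (∈-++⁺ˡ; ∈-++⁺ʳ; ∈-map⁺; ∈-map⁻; ∈-filter⁺; ∈-filter⁻; foldr-selective)
import Data.List.Relation.Unary.All as All
import Data.List.Relation.Unary.Any as Any
open import Data.List.Relation.Unary.All.Properties using (all⁺; all⁻)
open import Data.List.Relation.Unary.Any.Properties using (any⁺; any⁻)
open import Algebra.Bundles using (CommutativeSemiring; CommutativeRing)
open import Algebra.Structures.Biased using (isCommutativeSemiringˡ; isCommutativeMonoidˡ)

-- A polynomial in x, y, s is a power series in x whose coefficients are power
-- series in y whose coefficients are power series in s, and the product _*P_ is
-- the threefold Cauchy product; so the laws follow from the general fact that
-- ℕ-indexed series over a commutative semiring form a commutative semiring.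
module PowerSeries {c ℓ} (R : CommutativeSemiring c ℓ) where
  open CommutativeSemiring R hiding (zero)
  open import Relation.Binary.Reasoning.Setoid setoid
  open import Algebra.Properties.CommutativeSemigroup +-commutativeSemigroup
    using (interchange)

  Series : Set c
  Series = ℕ → Carrier

  infix 4 _≋_
  _≋_ : Series → Series → Set ℓ
  f ≋ g = ∀ i → f i ≈ g i

  sumTo : (ℕ → Carrier) → ℕ → Carrier
  sumTo f zero    = f zero
  sumTo f (suc a) = f (suc a) + sumTo f a

  sumTo-cong : ∀ {f g} a → (∀ i → i ≤ a → f i ≈ g i) → sumTo f a ≈ sumTo g a
  sumTo-cong zero    e = e zero z≤n
  sumTo-cong (suc a) e = +-cong (e (suc a) ≤-refl) (sumTo-cong a (λ i i≤a → e i (m≤n⇒m≤1+n i≤a)))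

  sumTo-+ : ∀ f g a → sumTo (λ i → f i + g i) a ≈ sumTo f a + sumTo g a
  sumTo-+ f g zero    = refl
  sumTo-+ f g (suc a) = trans (+-congˡ (sumTo-+ f g a)) (interchange _ _ _ _)

  sumTo-*ˡ : ∀ x f a → sumTo (λ i → x * f i) a ≈ x * sumTo f a
  sumTo-*ˡ x f zero    = refl
  sumTo-*ˡ x f (suc a) = trans (+-congˡ (sumTo-*ˡ x f a)) (sym (distribˡ _ _ _))

  sumTo-zero : ∀ f a → f ≋ (λ _ → 0#) → sumTo f a ≈ 0#
  sumTo-zero f zero    e = e zero
  sumTo-zero f (suc a) e = trans (+-cong (e (suc a)) (sumTo-zero f a e)) (+-identityˡ 0#)

  sumTo-suc : ∀ f a → sumTo f (suc a) ≈ f 0 + sumTo (λ i → f (suc i)) a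
  sumTo-suc f zero    = +-comm _ _
  sumTo-suc f (suc a) = begin
    f (suc (suc a)) + sumTo f (suc a)               ≈⟨ +-congˡ (sumTo-suc f a) ⟩
    f (suc (suc a)) + (f 0 + sumTo (λ i → f (suc i)) a) ≈⟨ x∙yz≈y∙xz _ _ _ ⟩
    f 0 + (f (suc (suc a)) + sumTo (λ i → f (suc i)) a) ∎
    where open import Algebra.Properties.CommutativeSemigroup +-commutativeSemigroup
            using (x∙yz≈y∙xz)

  conv : Series → Series → Series
  conv f g a = sumTo (λ i → f i * g (a ∸ i)) a

  conv-sucˡ : ∀ f g a → conv f g (suc a) ≈ f 0 * g (suc a) + conv (λ i → f (suc i)) g a
  conv-sucˡ f g a = sumTo-suc (λ i → f i * g (suc a ∸ i)) a

  conv-sucʳ : ∀ f g a → conv f g (suc a) ≈ f (suc a) * g 0 + conv f (λ i → g (suc i)) a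
  conv-sucʳ f g a = +-cong (*-congˡ (reflexive (≡.cong g (n∸n≡0 a))))
    (sumTo-cong a (λ i i≤a → *-congˡ (reflexive (≡.cong g (+-∸-assoc 1 i≤a)))))

  conv-cong : ∀ {f f' g g'} → f ≋ f' → g ≋ g' → conv f g ≋ conv f' g'
  conv-cong ef eg a = sumTo-cong a (λ i _ → *-cong (ef i) (eg (a ∸ i)))

  conv-comm : ∀ f g → conv f g ≋ conv g f
  conv-comm f g zero    = *-comm _ _
  conv-comm f g (suc a) = begin
    conv f g (suc a)                             ≈⟨ conv-sucˡ f g a ⟩
    f 0 * g (suc a) + conv (λ i → f (suc i)) g a ≈⟨ +-cong (*-comm _ _) (conv-comm _ g a) ⟩
    g (suc a) * f 0 + conv g (λ i → f (suc i)) a ≈⟨ sym (conv-sucʳ g f a) ⟩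
    conv g f (suc a)                             ∎

  conv-distribʳ : ∀ h u v → conv (λ i → u i + v i) h ≋ (λ a → conv u h a + conv v h a)
  conv-distribʳ h u v a = trans (sumTo-cong a (λ i _ → distribʳ (h (a ∸ i)) (u i) (v i)))
    (sumTo-+ (λ i → u i * h (a ∸ i)) (λ i → v i * h (a ∸ i)) a)

  conv-*ˡ : ∀ x u h → conv (λ i → x * u i) h ≋ (λ a → x * conv u h a)
  conv-*ˡ x u h a = trans (sumTo-cong a (λ i _ → *-assoc x (u i) (h (a ∸ i))))
    (sumTo-*ˡ x (λ i → u i * h (a ∸ i)) a)

  conv-assoc : ∀ f g h → conv (conv f g) h ≋ conv f (conv g h)
  conv-assoc f g h zero    = *-assoc _ _ _
  conv-assoc f g h (suc a) = begin
    conv (conv f g) h (suc a)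
      ≈⟨ conv-sucˡ (conv f g) h a ⟩
    (f 0 * g 0) * h (suc a) + conv (λ i → conv f g (suc i)) h a
      ≈⟨ +-congˡ (conv-cong {g = h} (conv-sucˡ f g) (λ _ → refl) a) ⟩
    (f 0 * g 0) * h (suc a) + conv (λ i → f 0 * g (suc i) + conv f' g i) h a
      ≈⟨ +-congˡ (conv-distribʳ h (λ i → f 0 * g (suc i)) (conv f' g) a) ⟩
    (f 0 * g 0) * h (suc a) + (conv (λ i → f 0 * g (suc i)) h a + conv (conv f' g) h a)
      ≈⟨ +-congˡ (+-cong (conv-*ˡ (f 0) g' h a) (conv-assoc f' g h a)) ⟩
    (f 0 * g 0) * h (suc a) + (f 0 * conv g' h a + conv f' (conv g h) a)
      ≈⟨ sym (+-assoc _ _ _) ⟩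
    ((f 0 * g 0) * h (suc a) + f 0 * conv g' h a) + conv f' (conv g h) a
      ≈⟨ +-congʳ (trans (+-congʳ (*-assoc _ _ _)) (sym (distribˡ _ _ _))) ⟩
    f 0 * (g 0 * h (suc a) + conv g' h a) + conv f' (conv g h) a
      ≈⟨ +-congʳ (*-congˡ (sym (conv-sucˡ g h a))) ⟩
    f 0 * conv g h (suc a) + conv f' (conv g h) a
      ≈⟨ sym (conv-sucˡ f (conv g h) a) ⟩
    conv f (conv g h) (suc a) ∎
    where
    f' g' : Series
    f' i = f (suc i)
    g' i = g (suc i)

  zeroS : Series
  zeroS _ = 0#

  constS : Carrier → Series
  constS x zero    = x
  constS x (suc _) = 0#

  oneS : Series
  oneS = constS 1#

  conv-zeroˡ : ∀ h → conv zeroS h ≋ zeroS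
  conv-zeroˡ h a = sumTo-zero _ a (λ i → zeroˡ _)

  conv-constˡ : ∀ x g → conv (constS x) g ≋ (λ a → x * g a)
  conv-constˡ x g zero    = refl
  conv-constˡ x g (suc a) = begin
    conv (constS x) g (suc a)      ≈⟨ conv-sucˡ (constS x) g a ⟩
    x * g (suc a) + conv zeroS g a ≈⟨ +-congˡ (conv-zeroˡ g a) ⟩
    x * g (suc a) + 0#             ≈⟨ +-identityʳ _ ⟩
    x * g (suc a)                  ∎

  conv-identityˡ : ∀ h → conv oneS h ≋ h
  conv-identityˡ h a = trans (conv-constˡ 1# h a) (*-identityˡ (h a))

  seriesSemiring : CommutativeSemiring c ℓ
  seriesSemiring = record
    { Carrier = Series ; _≈_ = _≋_ ; _+_ = λ f g i → f i + g i ; _*_ = conv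
    ; 0# = zeroS ; 1# = oneS
    ; isCommutativeSemiring = isCommutativeSemiringˡ record
      { +-isCommutativeMonoid = isCommutativeMonoidˡ record
        { isSemigroup = record
          { isMagma = record { isEquivalence = ≋-isEquivalence
                             ; ∙-cong = λ e e' i → +-cong (e i) (e' i) }
          ; assoc = λ f g h i → +-assoc (f i) (g i) (h i) }
        ; identityˡ = λ f i → +-identityˡ (f i)
        ; comm = λ f g i → +-comm (f i) (g i) }
      ; *-isCommutativeMonoid = isCommutativeMonoidˡ record
        { isSemigroup = record
          { isMagma = record { isEquivalence = ≋-isEquivalence ; ∙-cong = conv-cong }
          ; assoc = conv-assoc }
        ; identityˡ = conv-identityˡ
        ; comm = conv-comm }
      ; distribʳ = conv-distribʳ
      ; zeroˡ = conv-zeroˡ } }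
    where
    ≋-isEquivalence : IsEquivalence _≋_
    ≋-isEquivalence = record
      { refl = λ i → refl ; sym = λ e i → sym (e i) ; trans = λ e e' i → trans (e i) (e' i) }

module _ {c ℓ} (R : CommutativeSemiring c ℓ) where
  open CommutativeSemiring R using (_≈_; +-congˡ; refl)
  open PowerSeries R using (Series; sumTo; seriesSemiring)
  private module S = PowerSeries seriesSemiring

  sumTo-coeff : ∀ (f : ℕ → Series) a i → S.sumTo f a i ≈ sumTo (λ k → f k i) a
  sumTo-coeff f zero    i = refl
  sumTo-coeff f (suc a) i = +-congˡ (sumTo-coeff f a i)

module _ {c ℓ} (R : CommutativeSemiring c ℓ) where
  open CommutativeSemiring R

  withOperations : (_⊛_ : Carrier → Carrier → Carrier) (o₀ o₁ : Carrier) →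
    (∀ x y → x ⊛ y ≈ x * y) → o₀ ≈ 0# → o₁ ≈ 1# → CommutativeSemiring c ℓ
  withOperations _⊛_ o₀ o₁ ⊛≈* o₀≈0 o₁≈1 = record
    { Carrier = Carrier ; _≈_ = _≈_ ; _+_ = _+_ ; _*_ = _⊛_ ; 0# = o₀ ; 1# = o₁
    ; isCommutativeSemiring = isCommutativeSemiringˡ record
      { +-isCommutativeMonoid = isCommutativeMonoidˡ record
        { isSemigroup = +-isSemigroup
        ; identityˡ = λ x → trans (+-congʳ o₀≈0) (+-identityˡ x)
        ; comm = +-comm }
      ; *-isCommutativeMonoid = isCommutativeMonoidˡ record
        { isSemigroup = record
          { isMagma = record
            { isEquivalence = isEquivalence
            ; ∙-cong = λ e e' → trans (⊛≈* _ _) (trans (*-cong e e') (sym (⊛≈* _ _))) }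
          ; assoc = λ x y z → begin
              (x ⊛ y) ⊛ z ≈⟨ trans (⊛≈* _ _) (*-congʳ (⊛≈* x y)) ⟩
              (x * y) * z ≈⟨ *-assoc x y z ⟩
              x * (y * z) ≈⟨ sym (trans (⊛≈* _ _) (*-congˡ (⊛≈* y z))) ⟩
              x ⊛ (y ⊛ z) ∎ }
        ; identityˡ = λ x → trans (⊛≈* o₁ x) (trans (*-congʳ o₁≈1) (*-identityˡ x))
        ; comm = λ x y → trans (⊛≈* x y) (trans (*-comm x y) (sym (⊛≈* y x))) }
      ; distribʳ = λ x y z → begin
          (y + z) ⊛ x   ≈⟨ ⊛≈* _ _ ⟩
          (y + z) * x   ≈⟨ distribʳ x y z ⟩
          y * x + z * x ≈⟨ sym (+-cong (⊛≈* y x) (⊛≈* z x)) ⟩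
          y ⊛ x + z ⊛ x ∎
      ; zeroˡ = λ x → trans (⊛≈* o₀ x) (trans (*-congʳ o₀≈0) (trans (zeroˡ x) (sym o₀≈0))) } }
    where open import Relation.Binary.Reasoning.Setoid setoid

module Polynomials {c ℓ} (F : Field c ℓ) where
  open FieldOps F
  open PolyRing F
  private
    R₀ R₁ R₂ : CommutativeSemiring c ℓ
    R₀ = CommutativeRing.commutativeSemiring commutativeRing
    R₁ = PowerSeries.seriesSemiring R₀
    R₂ = PowerSeries.seriesSemiring R₁
    module S₀ = PowerSeries R₀
    module S₁ = PowerSeries R₁
    module S₂ = PowerSeries R₂
  open CommutativeSemiring R₀ using (refl; sym; +-cong)
  open import Relation.Binary.Reasoning.Setoid (CommutativeSemiring.setoid R₀)

  *P≈conv : ∀ p q → p *P q ≈P S₂.conv p q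
  *P≈conv p q a b d = sym (begin
    S₂.conv p q a b d
      ≈⟨ sumTo-coeff R₁ (λ i → S₁.conv (p i) (q (a ∸ i))) a b d ⟩
    S₁.sumTo (λ i → S₁.conv (p i) (q (a ∸ i)) b) a d
      ≈⟨ sumTo-coeff R₀ (λ i → S₁.conv (p i) (q (a ∸ i)) b) a d ⟩
    S₀.sumTo (λ i → S₁.conv (p i) (q (a ∸ i)) b d) a
      ≈⟨ S₀.sumTo-cong a (λ i _ → sumTo-coeff R₀ (λ j → S₀.conv (p i j) (q (a ∸ i) (b ∸ j))) b d) ⟩
    S₀.sumTo (λ i → S₀.sumTo (λ j → S₀.conv (p i j) (q (a ∸ i) (b ∸ j)) d) b) a
      ≈⟨ sym (sumTo≈ (λ i → sumTo≈ (λ j → sumTo≈ (λ l → refl) d) b) a) ⟩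
    (p *P q) a b d ∎)
    where
    sumTo≈ : ∀ {f g} → (∀ i → f i ≈ g i) → ∀ a → sumTo f a ≈ S₀.sumTo g a
    sumTo≈ e zero    = e zero
    sumTo≈ e (suc a) = +-cong (e (suc a)) (sumTo≈ e a)

  constP≈constS : ∀ r → constP r ≈P S₂.constS (S₁.constS (S₀.constS r))
  constP≈constS r zero    zero    zero    = refl
  constP≈constS r zero    zero    (suc d) = refl
  constP≈constS r zero    (suc b) d       = refl
  constP≈constS r (suc a) b       d       = refl

  0P≈zero : 0P ≈P λ _ _ _ → 0#
  0P≈zero zero    zero    zero    = refl
  0P≈zero zero    zero    (suc d) = refl
  0P≈zero zero    (suc b) d       = refl
  0P≈zero (suc a) b       d       = refl

  polynomialSemiring : CommutativeSemiring c ℓ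
  polynomialSemiring =
    withOperations (PowerSeries.seriesSemiring R₂) _*P_ 0P 1P *P≈conv 0P≈zero (constP≈constS 1#)

  scale : Carrier → Pol → Pol
  scale r p a b d = r * p a b d

  constP*P : ∀ r p → constP r *P p ≈P scale r p
  constP*P r p a b d = begin
    (constP r *P p) a b d      ≈⟨ *P≈conv (constP r) p a b d ⟩
    S₂.conv (constP r) p a b d ≈⟨ S₂.conv-cong {g = p} (constP≈constS r) (λ _ _ _ → refl) a b d ⟩
    S₂.conv (S₂.constS (S₁.constS (S₀.constS r))) p a b d
      ≈⟨ S₂.conv-constˡ (S₁.constS (S₀.constS r)) p a b d ⟩
    S₁.conv (S₁.constS (S₀.constS r)) (p a) b d ≈⟨ S₁.conv-constˡ (S₀.constS r) (p a) b d ⟩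
    S₀.conv (S₀.constS r) (p a b) d             ≈⟨ S₀.conv-constˡ r (p a b) d ⟩
    r * p a b d ∎

module FiniteSubsets where
  open ≡ using (refl; sym; trans; cong)
  open import Data.Nat using (_+_; _<_)
  open import Data.Nat.Properties
    using (+-suc; +-mono-≤; ≤-<-trans; <-irrefl; +-comm; +-cancelˡ-≡; ≤-antisym; +-monoˡ-≤; module ≤-Reasoning)
  open import Data.Fin.Subset.Properties using (∩-comm; ∣p∩q∣≤∣p∣)

  ⊆ᵇ⇒⊆ : ∀ {n} {p q : Subset n} → p ⊆ᵇ q ≡ true → p ⊆ q
  ⊆ᵇ⇒⊆ {p = inside ∷ p}  {inside ∷ q} h here       = here
  ⊆ᵇ⇒⊆ {p = inside ∷ p}  {b ∷ q}      h (there x) = there (⊆ᵇ⇒⊆ (∧-conicalʳ b _ h) x)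
  ⊆ᵇ⇒⊆ {p = outside ∷ p} {b ∷ q}      h (there x) = there (⊆ᵇ⇒⊆ h x)

  ⊆⇒⊆ᵇ : ∀ {n} {p q : Subset n} → p ⊆ q → p ⊆ᵇ q ≡ true
  ⊆⇒⊆ᵇ {p = []}          {[]}    p⊆q = refl
  ⊆⇒⊆ᵇ {p = outside ∷ p} {b ∷ q} p⊆q = ⊆⇒⊆ᵇ (drop-∷-⊆ p⊆q)
  ⊆⇒⊆ᵇ {p = inside ∷ p}  {b ∷ q} p⊆q with p⊆q here
  ... | here = ⊆⇒⊆ᵇ (drop-∷-⊆ p⊆q)

  ∈-subsets : ∀ {n} (p : Subset n) → p ∈L subsets n
  ∈-subsets []            = Any.here refl
  ∈-subsets (outside ∷ p) = ∈-++⁺ˡ (∈-map⁺ (outside ∷_) (∈-subsets p))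
  ∈-subsets {suc n} (inside ∷ p) =
    ∈-++⁺ʳ (map (outside ∷_) (subsets n)) (∈-map⁺ (inside ∷_) (∈-subsets p))

  x∈p─q⇒x∉q : ∀ {n} {x : Fin n} (p q : Subset n) → x ∈ p ─ q → x ∉ q
  x∈p─q⇒x∉q (_ ∷ p) (outside ∷ q) (there x∈) (there x∈q) = x∈p─q⇒x∉q p q x∈ x∈q
  x∈p─q⇒x∉q (_ ∷ p) (inside ∷ q)  (there x∈) (there x∈q) = x∈p─q⇒x∉q p q x∈ x∈q
  x∈p─q⇒x∉q (inside ∷ p) (outside ∷ q) here ()

  ∪-least : ∀ {n} {p q r : Subset n} → p ⊆ r → q ⊆ r → p ∪ q ⊆ r
  ∪-least {p = p} {q} p⊆r q⊆r x∈ = [ p⊆r , q⊆r ]′ (x∈p∪q⁻ p q x∈)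

  ⁅⁆⊆ : ∀ {n} {x : Fin n} {p : Subset n} → x ∈ p → ⁅ x ⁆ ⊆ p
  ⁅⁆⊆ {x = x} x∈p y∈ rewrite x∈⁅y⁆⇒x≡y x y∈ = x∈p

  p─[p─q]≡q : ∀ {n} {p q : Subset n} → q ⊆ p → p ─ (p ─ q) ≡ q
  p─[p─q]≡q {p = []}          {[]}          q⊆p = refl
  p─[p─q]≡q {p = outside ∷ p} {outside ∷ q} q⊆p = cong (outside ∷_) (p─[p─q]≡q (drop-∷-⊆ q⊆p))
  p─[p─q]≡q {p = inside ∷ p}  {outside ∷ q} q⊆p = cong (outside ∷_) (p─[p─q]≡q (drop-∷-⊆ q⊆p))
  p─[p─q]≡q {p = inside ∷ p}  {inside ∷ q}  q⊆p = cong (inside ∷_) (p─[p─q]≡q (drop-∷-⊆ q⊆p))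
  p─[p─q]≡q {p = outside ∷ p} {inside ∷ q}  q⊆p with () ← q⊆p here

  ∣p∣≡∣p∩q∣+∣p─q∣ : ∀ {n} (p q : Subset n) → ∣ p ∣ ≡ ∣ p ∩ q ∣ + ∣ p ─ q ∣
  ∣p∣≡∣p∩q∣+∣p─q∣ []            []            = refl
  ∣p∣≡∣p∩q∣+∣p─q∣ (outside ∷ p) (outside ∷ q) = ∣p∣≡∣p∩q∣+∣p─q∣ p q
  ∣p∣≡∣p∩q∣+∣p─q∣ (outside ∷ p) (inside ∷ q)  = ∣p∣≡∣p∩q∣+∣p─q∣ p q
  ∣p∣≡∣p∩q∣+∣p─q∣ (inside ∷ p)  (inside ∷ q)  = cong suc (∣p∣≡∣p∩q∣+∣p─q∣ p q)
  ∣p∣≡∣p∩q∣+∣p─q∣ (inside ∷ p)  (outside ∷ q) =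
    trans (cong suc (∣p∣≡∣p∩q∣+∣p─q∣ p q)) (sym (+-suc _ _))

  ∣p∣≡∣p─q∣+∣q∩p∣ : ∀ {n} (p q : Subset n) → ∣ p ∣ ≡ ∣ p ─ q ∣ + ∣ q ∩ p ∣
  ∣p∣≡∣p─q∣+∣q∩p∣ p q = trans (∣p∣≡∣p∩q∣+∣p─q∣ p q)
    (trans (+-comm ∣ p ∩ q ∣ _) (cong (∣ p ─ q ∣ +_) (cong ∣_∣ (∩-comm p q))))

  ∣p─q∣+∣q∣≡∣p∣ : ∀ {n} {p q : Subset n} → q ⊆ p → ∣ p ─ q ∣ + ∣ q ∣ ≡ ∣ p ∣
  ∣p─q∣+∣q∣≡∣p∣ {p = p} {q} q⊆p = sym (trans (∣p∣≡∣p─q∣+∣q∩p∣ p q) (cong (∣ p ─ q ∣ +_) ∣q∩p∣≡∣q∣))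
    where
    ∣q∩p∣≡∣q∣ : ∣ q ∩ p ∣ ≡ ∣ q ∣
    ∣q∩p∣≡∣q∣ = ≤-antisym (∣p∩q∣≤∣p∣ q p) (p⊆q⇒∣p∣≤∣q∣ (λ x∈ → x∈p∩q⁺ (x∈ , q⊆p x∈)))

  ∣p─p∣≡0 : ∀ {n} (p : Subset n) → ∣ p ─ p ∣ ≡ 0
  ∣p─p∣≡0 []            = refl
  ∣p─p∣≡0 (outside ∷ p) = ∣p─p∣≡0 p
  ∣p─p∣≡0 (inside ∷ p)  = ∣p─p∣≡0 p

  ∣p∪q∣≤∣p∣+∣q∣ : ∀ {n} (p q : Subset n) → ∣ p ∪ q ∣ ≤ ∣ p ∣ + ∣ q ∣
  ∣p∪q∣≤∣p∣+∣q∣ []            []            = z≤n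
  ∣p∪q∣≤∣p∣+∣q∣ (outside ∷ p) (outside ∷ q) = ∣p∪q∣≤∣p∣+∣q∣ p q
  ∣p∪q∣≤∣p∣+∣q∣ (inside ∷ p)  (b ∷ q)       =
    s≤s (≤-trans (∣p∪q∣≤∣p∣+∣q∣ p q) (+-mono-≤ ≤-refl (∣p∣≤∣x∷p∣ b q)))
  ∣p∪q∣≤∣p∣+∣q∣ (outside ∷ p) (inside ∷ q)  =
    ≤-trans (s≤s (∣p∪q∣≤∣p∣+∣q∣ p q)) (≤-reflexive (sym (+-suc _ _)))

  ∣p∪⁅x⁆∣≡1+∣p∣ : ∀ {n} (p : Subset n) {x} → x ∉ p → ∣ p ∪ ⁅ x ⁆ ∣ ≡ suc ∣ p ∣
  ∣p∪⁅x⁆∣≡1+∣p∣ (outside ∷ p) {zero}  x∉p = cong (suc ∘ ∣_∣) (∪-identityʳ p)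
  ∣p∪⁅x⁆∣≡1+∣p∣ (inside ∷ p)  {zero}  x∉p = contradiction here x∉p
  ∣p∪⁅x⁆∣≡1+∣p∣ (outside ∷ p) {suc x} x∉p = ∣p∪⁅x⁆∣≡1+∣p∣ p (x∉p ∘ there)
  ∣p∪⁅x⁆∣≡1+∣p∣ (inside ∷ p)  {suc x} x∉p = cong suc (∣p∪⁅x⁆∣≡1+∣p∣ p (x∉p ∘ there))

  ∣p∣<∣q∣⇒∃∈q∉p : ∀ {n} (p q : Subset n) → ∣ p ∣ < ∣ q ∣ → ∃[ x ] (x ∈ q × x ∉ p)
  ∣p∣<∣q∣⇒∃∈q∉p (b ∷ p) (outside ∷ q) lt with ∣p∣<∣q∣⇒∃∈q∉p p q (≤-<-trans (∣p∣≤∣x∷p∣ b p) lt)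
  ... | x , x∈q , x∉p = suc x , there x∈q , x∉p ∘ drop-there
  ∣p∣<∣q∣⇒∃∈q∉p (outside ∷ p) (inside ∷ q) lt = zero , here , λ ()
  ∣p∣<∣q∣⇒∃∈q∉p (inside ∷ p)  (inside ∷ q) (s≤s lt) with ∣p∣<∣q∣⇒∃∈q∉p p q lt
  ... | x , x∈q , x∉p = suc x , there x∈q , x∉p ∘ drop-there

  ⊆-card-reverse : ∀ {n} {p q : Subset n} → p ⊆ q → ∣ q ∣ ≤ ∣ p ∣ → q ⊆ p
  ⊆-card-reverse {p = p} {q} p⊆q q≤p {x} x∈q with x ∈? p
  ... | yes x∈p = x∈p
  ... | no  x∉p = contradiction (≤-<-trans q≤p (p⊂q⇒∣p∣<∣q∣ (p⊆q , x , x∈q , x∉p))) (<-irrefl refl)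

  Disjoint : ∀ {n} → Subset n → Subset n → Set
  Disjoint p q = ∀ {x} → x ∈ p → x ∉ q

  ⊆─⇒Disjoint : ∀ {n} {p q r : Subset n} → p ⊆ q ─ r → Disjoint p r
  ⊆─⇒Disjoint {q = q} {r} p⊆ x∈p = x∈p─q⇒x∉q q r (p⊆ x∈p)

  Disjoint-sym : ∀ {n} {p q : Subset n} → Disjoint p q → Disjoint q p
  Disjoint-sym p#q x∈q x∈p = p#q x∈p x∈q

  ⊆-Disjoint : ∀ {n} {p q r : Subset n} → p ⊆ q → Disjoint q r → Disjoint p r
  ⊆-Disjoint p⊆q q#r x∈p = q#r (p⊆q x∈p)

  ∪-Disjoint : ∀ {n} {p q r : Subset n} → Disjoint p r → Disjoint q r → Disjoint (p ∪ q) r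
  ∪-Disjoint {p = p} {q} p#r q#r x∈ = [ p#r , q#r ]′ (x∈p∪q⁻ p q x∈)

  -- The counting step of the augmentation property of the dual: if K and K' are
  -- equally large, K ─ I ⊆ K' and K misses J, then fewer than |J| elements of J
  -- lie in K' or in I (provided |I| < |J|).
  exchange-count : ∀ {n} (I J K K' : Subset n) → ∣ K' ∣ ≡ ∣ K ∣ → K ─ I ⊆ K' → Disjoint K J →
    ∣ I ∣ < ∣ J ∣ → ∣ (J ∩ K') ∪ (I ∩ J) ∣ < ∣ J ∣
  exchange-count I J K K' ∣K'∣≡∣K∣ K─I⊆K' K#J ∣I∣<∣J∣ = begin-strict
    ∣ (J ∩ K') ∪ (I ∩ J) ∣   ≤⟨ ∣p∪q∣≤∣p∣+∣q∣ (J ∩ K') (I ∩ J) ⟩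
    ∣ J ∩ K' ∣ + ∣ I ∩ J ∣   ≤⟨ +-monoˡ-≤ _ (p⊆q⇒∣p∣≤∣q∣ J∩K'⊆) ⟩
    ∣ K' ─ (K ─ I) ∣ + ∣ I ∩ J ∣ ≡⟨ cong (_+ ∣ I ∩ J ∣) new≡K∩I ⟩
    ∣ K ∩ I ∣ + ∣ I ∩ J ∣     ≤⟨ +-monoˡ-≤ _ (p⊆q⇒∣p∣≤∣q∣ K∩I⊆) ⟩
    ∣ I ─ J ∣ + ∣ I ∩ J ∣     ≡⟨ +-comm ∣ I ─ J ∣ _ ⟩
    ∣ I ∩ J ∣ + ∣ I ─ J ∣     ≡⟨ sym (∣p∣≡∣p∩q∣+∣p─q∣ I J) ⟩
    ∣ I ∣                    <⟨ ∣I∣<∣J∣ ⟩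
    ∣ J ∣                    ∎
    where
    open ≤-Reasoning
    new≡K∩I : ∣ K' ─ (K ─ I) ∣ ≡ ∣ K ∩ I ∣
    new≡K∩I = +-cancelˡ-≡ ∣ K ─ I ∣ _ _ (begin-equality
      ∣ K ─ I ∣ + ∣ K' ─ (K ─ I) ∣         ≡⟨ cong (_+ ∣ K' ─ (K ─ I) ∣) K─I-kept ⟩
      ∣ K' ∩ (K ─ I) ∣ + ∣ K' ─ (K ─ I) ∣  ≡⟨ sym (∣p∣≡∣p∩q∣+∣p─q∣ K' (K ─ I)) ⟩
      ∣ K' ∣                              ≡⟨ ∣K'∣≡∣K∣ ⟩
      ∣ K ∣                               ≡⟨ ∣p∣≡∣p∩q∣+∣p─q∣ K I ⟩
      ∣ K ∩ I ∣ + ∣ K ─ I ∣                ≡⟨ +-comm ∣ K ∩ I ∣ _ ⟩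
      ∣ K ─ I ∣ + ∣ K ∩ I ∣                ∎)
      where
      K─I-kept : ∣ K ─ I ∣ ≡ ∣ K' ∩ (K ─ I) ∣
      K─I-kept = ≤-antisym (p⊆q⇒∣p∣≤∣q∣ (λ x∈ → x∈p∩q⁺ (K─I⊆K' x∈ , x∈))) (∣p∩q∣≤∣q∣ K' (K ─ I))
    J∩K'⊆ : J ∩ K' ⊆ K' ─ (K ─ I)
    J∩K'⊆ x∈ with x∈p∩q⁻ J K' x∈
    ... | x∈J , x∈K' = x∈p∧x∉q⇒x∈p─q x∈K' (λ x∈K─I → K#J (p─q⊆p K I x∈K─I) x∈J)
    K∩I⊆ : K ∩ I ⊆ I ─ J
    K∩I⊆ x∈ with x∈p∩q⁻ K I x∈
    ... | x∈K , x∈I = x∈p∧x∉q⇒x∈p─q x∈I (K#J x∈K)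

module ListReading where
  open ≡ using (refl)
  open import Data.Nat using (_⊔_)
  open import Data.Nat.Properties using (m≤m⊔n; m≤n⊔m)

  T⇒≡ : ∀ {b} → T b → b ≡ true
  T⇒≡ = Equivalence.to T-≡

  ≡⇒T : ∀ {b} → b ≡ true → T b
  ≡⇒T = Equivalence.from T-≡

  all-true⁻ : ∀ {A : Set} (p : A → Bool) xs → all p xs ≡ true → ∀ {x} → x ∈L xs → p x ≡ true
  all-true⁻ p xs h x∈ = T⇒≡ (All.lookup (all⁺ p xs (≡⇒T h)) x∈)

  all-true⁺ : ∀ {A : Set} (p : A → Bool) xs → (∀ {x} → x ∈L xs → p x ≡ true) → all p xs ≡ true
  all-true⁺ p xs h = T⇒≡ (all⁻ p (All.tabulate (≡⇒T ∘ h)))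

  any-true⁻ : ∀ {A : Set} (p : A → Bool) xs → any p xs ≡ true → ∃[ x ] (p x ≡ true)
  any-true⁻ p xs h with Any.satisfied (any⁻ p xs (≡⇒T h))
  ... | x , px = x , T⇒≡ px

  any-true⁺ : ∀ {A : Set} (p : A → Bool) {xs x} → x ∈L xs → p x ≡ true → any p xs ≡ true
  any-true⁺ p x∈ h = T⇒≡ (any⁺ p (Any.map (λ { refl → ≡⇒T h }) x∈))

  max-ub : ∀ {n ns} → n ∈L ns → n ≤ foldr _⊔_ 0 ns
  max-ub (Any.here refl) = m≤m⊔n _ _
  max-ub (Any.there n∈) = ≤-trans (max-ub n∈) (m≤n⊔m _ _)

module RawMatroidFacts (M : RawMatroid) where
  open RawMatroid M
  open ListReading
  open FiniteSubsets
  open ≡ using (refl; sym; trans; cong₂)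
  open import Data.Nat using (_⊔_)
  open import Data.Nat.Properties using (⊔-sel)

  private
    indepIn : Subset size → Subset size → Bool
    indepIn A B = indep B ∧ (B ⊆ᵇ A)

    noLargerIndep : Subset size → Subset size → Bool
    noLargerIndep B C = not (indep C ∧ (B ⊆ᵇ C) ∧ not (C ⊆ᵇ B))

  rank-ub : ∀ {A B} → indep B ≡ true → B ⊆ A → ∣ B ∣ ≤ rank M A
  rank-ub {A} {B} iB B⊆A = max-ub (∈-map⁺ ∣_∣
    (∈-filter⁺ (T? ∘ indepIn A) (∈-subsets B) (≡⇒T (cong₂ _∧_ iB (⊆⇒⊆ᵇ B⊆A)))))

  rank-attained : indep ∅ ≡ true → ∀ A → ∃[ B ] (indep B ≡ true × B ⊆ A × ∣ B ∣ ≡ rank M A)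
  rank-attained i∅ A with foldr-selective ⊔-sel 0 (map ∣_∣ (filterᵇ (indepIn A) (subsets size)))
  ... | inj₁ r≡0 = ∅ , i∅ , ⊥⊆ , trans (∣⊥∣≡0 size) (sym r≡0)
  ... | inj₂ r∈ with ∈-map⁻ ∣_∣ r∈
  ...   | B , B∈ , r≡∣B∣ with ∈-filter⁻ (T? ∘ indepIn A) {xs = subsets size} B∈
  ...     | _ , TB = B , ∧-conicalˡ _ _ (T⇒≡ TB) , ⊆ᵇ⇒⊆ (∧-conicalʳ _ _ (T⇒≡ TB)) , sym r≡∣B∣

  isBasis⇒maximal : ∀ {B} → isBasis M B ≡ true →
    indep B ≡ true × (∀ {C} → indep C ≡ true → B ⊆ C → C ⊆ B)
  isBasis⇒maximal {B} h = ∧-conicalˡ _ _ h , maximal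
    where
    maximal : ∀ {C} → indep C ≡ true → B ⊆ C → C ⊆ B
    maximal {C} iC B⊆C with C ⊆ᵇ B in C⊆ᵇB | all-true⁻ (noLargerIndep B) (subsets size) (∧-conicalʳ _ _ h) (∈-subsets C)
    ... | true  | _          = ⊆ᵇ⇒⊆ C⊆ᵇB
    ... | false | notLarger rewrite iC | ⊆⇒⊆ᵇ B⊆C = contradiction notLarger λ ()

  maximal⇒isBasis : ∀ {B} → indep B ≡ true → (∀ {C} → indep C ≡ true → B ⊆ C → C ⊆ B) →
    isBasis M B ≡ true
  maximal⇒isBasis {B} iB maximal = cong₂ _∧_ iB (all-true⁺ (noLargerIndep B) (subsets size) (λ {C} _ → notLarger C))
    where
    notLarger : ∀ C → noLargerIndep B C ≡ true
    notLarger C with indep C in iC | B ⊆ᵇ C in B⊆ᵇC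
    ... | false | _     = refl
    ... | true  | false = refl
    ... | true  | true  rewrite ⊆⇒⊆ᵇ (maximal iC (⊆ᵇ⇒⊆ B⊆ᵇC)) = refl

  dual-indep⁻ : ∀ I → RawMatroid.indep (dual M) I ≡ true → ∃[ B ] (isBasis M B ≡ true × I ⊆ E ─ B)
  dual-indep⁻ I h =
    let B , hB = any-true⁻ (λ B → isBasis M B ∧ (I ⊆ᵇ (E ─ B))) (subsets size) (∧-conicalʳ (I ⊆ᵇ E) _ h)
    in B , ∧-conicalˡ _ _ hB , ⊆ᵇ⇒⊆ (∧-conicalʳ _ _ hB)

  dual-indep⁺ : ∀ I {B} → isBasis M B ≡ true → I ⊆ E ─ B → RawMatroid.indep (dual M) I ≡ true
  dual-indep⁺ I {B} bB I⊆ = cong₂ _∧_ (⊆⇒⊆ᵇ (⊆-trans I⊆ (p─q⊆p E B)))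
    (any-true⁺ _ (∈-subsets B) (cong₂ _∧_ bB (⊆⇒⊆ᵇ I⊆)))

module MatroidTheory (M : RawMatroid) (mat : IsMatroid M) where
  open RawMatroid M
  open IsMatroid mat
  open RawMatroidFacts M public
  open FiniteSubsets
  open ≡ using (sym; trans; cong; subst)
  open import Data.Nat using (_+_; _<_)
  open import Data.Nat.Properties
    using (+-identityʳ; +-suc; m<m+n; m+[n∸m]≡n; ≤-antisym; ≰⇒>; n<1⇒n≡0)

  fullRank : ℕ
  fullRank = rank M E

  rank-attainedᴹ : ∀ A → ∃[ B ] (indep B ≡ true × B ⊆ A × ∣ B ∣ ≡ rank M A)
  rank-attainedᴹ = rank-attained indep-∅

  rank≤card : ∀ A → rank M A ≤ ∣ A ∣
  rank≤card A with rank-attainedᴹ A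
  ... | B , _ , B⊆A , ∣B∣≡r = subst (_≤ ∣ A ∣) ∣B∣≡r (p⊆q⇒∣p∣≤∣q∣ B⊆A)

  rank-indep : ∀ {A} → indep A ≡ true → rank M A ≡ ∣ A ∣
  rank-indep {A} iA = ≤-antisym (rank≤card A) (rank-ub iA ⊆-refl)

  rank-dependent : ∀ {A} → indep A ≡ false → rank M A < ∣ A ∣
  rank-dependent {A} dA with rank-attainedᴹ A
  ... | B , iB , B⊆A , ∣B∣≡r = subst (_< ∣ A ∣) ∣B∣≡r (≰⇒> B≱A)
    where
    B≱A : ¬ (∣ A ∣ ≤ ∣ B ∣)
    B≱A A≤B = contradiction (trans (sym dA) (hereditary B A (⊆-card-reverse B⊆A A≤B) iB)) λ ()

  rank-point : ∀ {A} → ∣ A ∣ ≡ 1 → rank M A ≡ (if indep A then 1 else 0)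
  rank-point {A} ∣A∣≡1 with indep A in iA
  ... | true  = trans (rank-indep iA) ∣A∣≡1
  ... | false = n<1⇒n≡0 (subst (rank M A <_) ∣A∣≡1 (rank-dependent iA))

  indep≤fullRank : ∀ {C} → indep C ≡ true → ∣ C ∣ ≤ fullRank
  indep≤fullRank {C} iC = rank-ub iC (indep⊆E C iC)

  extend : ∀ {X Y} → indep X ≡ true → indep Y ≡ true → ∣ X ∣ ≤ ∣ Y ∣ →
    ∃[ Z ] (indep Z ≡ true × X ⊆ Z × Z ⊆ X ∪ Y × ∣ Z ∣ ≡ ∣ Y ∣)
  extend {X} {Y} iX iY X≤Y = grow (∣ Y ∣ ∸ ∣ X ∣) iX ⊆-refl (p⊆p∪q Y) (m+[n∸m]≡n X≤Y)
    where
    grow : ∀ k {W} → indep W ≡ true → X ⊆ W → W ⊆ X ∪ Y → ∣ W ∣ + k ≡ ∣ Y ∣ →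
      ∃[ Z ] (indep Z ≡ true × X ⊆ Z × Z ⊆ X ∪ Y × ∣ Z ∣ ≡ ∣ Y ∣)
    grow zero    {W} iW X⊆W W⊆ sizes = W , iW , X⊆W , W⊆ , trans (sym (+-identityʳ _)) sizes
    grow (suc k) {W} iW X⊆W W⊆ sizes
      with augment W Y iW iY (subst (∣ W ∣ <_) sizes (m<m+n ∣ W ∣ (s≤s z≤n)))
    ... | e , e∈Y , e∉W , iW+e = grow k iW+e (⊆-trans X⊆W (p⊆p∪q ⁅ e ⁆))
      (∪-least W⊆ (⁅⁆⊆ (q⊆p∪q X Y e∈Y)))
      (trans (cong (_+ k) (∣p∪⁅x⁆∣≡1+∣p∣ W e∉W)) (trans (sym (+-suc _ k)) sizes))

  IsBase : Subset size → Set
  IsBase B = indep B ≡ true × ∣ B ∣ ≡ fullRank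

  isBasis⇒IsBase : ∀ {B} → isBasis M B ≡ true → IsBase B
  isBasis⇒IsBase {B} h with isBasis⇒maximal h | rank-attainedᴹ E
  ... | iB , maximal | B₀ , iB₀ , _ , ∣B₀∣≡r with extend iB iB₀ (subst (∣ B ∣ ≤_) (sym ∣B₀∣≡r) (indep≤fullRank iB))
  ... | Z , iZ , B⊆Z , _ , ∣Z∣≡∣B₀∣ =
    iB , ≤-antisym (indep≤fullRank iB)
                   (subst (_≤ ∣ B ∣) (trans ∣Z∣≡∣B₀∣ ∣B₀∣≡r) (p⊆q⇒∣p∣≤∣q∣ (maximal iZ B⊆Z)))

  IsBase⇒isBasis : ∀ {B} → IsBase B → isBasis M B ≡ true
  IsBase⇒isBasis {B} (iB , ∣B∣≡r) = maximal⇒isBasis iB λ iC B⊆C →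
    ⊆-card-reverse B⊆C (subst (_ ≤_) (sym ∣B∣≡r) (indep≤fullRank iC))

  base-exists : ∃[ B ] IsBase B
  base-exists with rank-attainedᴹ E
  ... | B , iB , _ , ∣B∣≡r = B , iB , ∣B∣≡r

  extendToBase : ∀ {X D} → indep X ≡ true → IsBase D → ∃[ K ] (IsBase K × X ⊆ K × K ⊆ X ∪ D)
  extendToBase iX (iD , ∣D∣≡r) with extend iX iD (subst (_ ≤_) (sym ∣D∣≡r) (indep≤fullRank iX))
  ... | K , iK , X⊆K , K⊆ , ∣K∣≡∣D∣ = K , (iK , trans ∣K∣≡∣D∣ ∣D∣≡r) , X⊆K , K⊆

  extendAvoiding : ∀ {X D S} → indep X ≡ true → IsBase D → Disjoint X S → Disjoint D S →
    ∃[ K ] (IsBase K × X ⊆ K × Disjoint K S)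
  extendAvoiding iX bD X#S D#S =
    let K , bK , X⊆K , K⊆ = extendToBase iX bD in K , bK , X⊆K , ⊆-Disjoint K⊆ (∪-Disjoint X#S D#S)

module Deletion (M : RawMatroid) (mat : IsMatroid M) (T : Subset (RawMatroid.size M)) where
  open RawMatroid M
  open IsMatroid mat
  open MatroidTheory M mat using (rank-ub; rank-attainedᴹ)
  open FiniteSubsets
  open ≡ using (cong₂; subst)
  open import Data.Nat using (_<_)
  open import Data.Nat.Properties using (≤-antisym)

  private
    module D = RawMatroid (delete M T)
    module DF = RawMatroidFacts (delete M T)

  indepᴰ⁺ : ∀ {I} → indep I ≡ true → I ⊆ E ─ T → D.indep I ≡ true
  indepᴰ⁺ iI I⊆ = cong₂ _∧_ iI (⊆⇒⊆ᵇ I⊆)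

  indepᴰ⁻ : ∀ {I} → D.indep I ≡ true → indep I ≡ true × I ⊆ E ─ T
  indepᴰ⁻ h = ∧-conicalˡ _ _ h , ⊆ᵇ⇒⊆ (∧-conicalʳ _ _ h)

  isMatroid : IsMatroid (delete M T)
  isMatroid = record
    { indep⊆E    = λ I h → proj₂ (indepᴰ⁻ h)
    ; indep-∅    = indepᴰ⁺ indep-∅ ⊥⊆
    ; hereditary = λ I J J⊆I h → indepᴰ⁺ (hereditary I J J⊆I (proj₁ (indepᴰ⁻ h)))
                                         (⊆-trans J⊆I (proj₂ (indepᴰ⁻ h)))
    ; augment    = augmentᴰ }
    where
    augmentᴰ : ∀ I J → D.indep I ≡ true → D.indep J ≡ true → ∣ I ∣ < ∣ J ∣ →
      ∃[ e ] (e ∈ J × e ∉ I × D.indep (I ∪ ⁅ e ⁆) ≡ true)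
    augmentᴰ I J hI hJ lt with indepᴰ⁻ hI | indepᴰ⁻ hJ
    ... | iI , I⊆ | iJ , J⊆ with augment I J iI iJ lt
    ... | e , e∈J , e∉I , iI+e = e , e∈J , e∉I , indepᴰ⁺ iI+e (∪-least I⊆ (⁅⁆⊆ (J⊆ e∈J)))

  rankᴰ≡rank : ∀ {X} → X ⊆ E ─ T → rank (delete M T) X ≡ rank M X
  rankᴰ≡rank {X} X⊆ = ≤-antisym ≤rank ≥rank
    where
    ≤rank : rank (delete M T) X ≤ rank M X
    ≤rank with DF.rank-attained (IsMatroid.indep-∅ isMatroid) X
    ... | B , hB , B⊆X , ∣B∣≡r = subst (_≤ rank M X) ∣B∣≡r (rank-ub (proj₁ (indepᴰ⁻ hB)) B⊆X)
    ≥rank : rank M X ≤ rank (delete M T) X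
    ≥rank with rank-attainedᴹ X
    ... | B , iB , B⊆X , ∣B∣≡r = subst (_≤ rank (delete M T) X) ∣B∣≡r
      (DF.rank-ub (indepᴰ⁺ iB (⊆-trans B⊆X X⊆)) B⊆X)

module Duality (M : RawMatroid) (mat : IsMatroid M) where
  open RawMatroid M
  open IsMatroid mat
  open MatroidTheory M mat
  open FiniteSubsets
  open ≡ using (sym; trans; cong; cong₂)
  open import Data.Nat using (_+_; _<_)
  open import Data.Nat.Properties using (≤-antisym; +-assoc; +-mono-≤; +-monoʳ-≤; module ≤-Reasoning)

  private
    module M* = RawMatroid (dual M)
    module M*F = RawMatroidFacts (dual M)

  coindep⁻ : ∀ I → M*.indep I ≡ true → ∃[ B ] (IsBase B × I ⊆ E ─ B)
  coindep⁻ I h = let B , bB , I⊆ = dual-indep⁻ I h in B , isBasis⇒IsBase bB , I⊆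

  coindep⁺ : ∀ I {B} → IsBase B → I ⊆ E ─ B → M*.indep I ≡ true
  coindep⁺ I bB = dual-indep⁺ I (IsBase⇒isBasis bB)

  coindep-∅ : M*.indep ∅ ≡ true
  coindep-∅ = coindep⁺ ∅ (proj₂ base-exists) ⊥⊆

  -- augmentation: extend B₁ ─ J through B₂ to a base K missing J, then K ─ I
  -- through B₁ to a base K' missing I; counting finds e ∈ J outside K' and I
  augmentFromBases : ∀ {I J B₁ B₂} → IsBase B₁ → IsBase B₂ → I ⊆ E ─ B₁ → J ⊆ E ─ B₂ →
    ∣ I ∣ < ∣ J ∣ → ∃[ e ] (e ∈ J × e ∉ I × M*.indep (I ∪ ⁅ e ⁆) ≡ true)
  augmentFromBases {I} {J} {B₁} {B₂} bB₁ bB₂ I⊆ J⊆ ∣I∣<∣J∣ =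
    let K , bK , _ , K#J = extendAvoiding (hereditary B₁ (B₁ ─ J) (p─q⊆p B₁ J) (proj₁ bB₁)) bB₂
                             (x∈p─q⇒x∉q B₁ J) (Disjoint-sym (⊆─⇒Disjoint J⊆))
        K' , bK' , K─I⊆K' , K'#I = extendAvoiding (hereditary K (K ─ I) (p─q⊆p K I) (proj₁ bK)) bB₁
                                     (x∈p─q⇒x∉q K I) (Disjoint-sym (⊆─⇒Disjoint I⊆))
        e , e∈J , e∉W = ∣p∣<∣q∣⇒∃∈q∉p ((J ∩ K') ∪ (I ∩ J)) J
                          (exchange-count I J K K' (trans (proj₂ bK') (sym (proj₂ bK))) K─I⊆K' K#J ∣I∣<∣J∣)
        e∉I : e ∉ I
        e∉I e∈I = e∉W (q⊆p∪q (J ∩ K') (I ∩ J) (x∈p∩q⁺ (e∈I , e∈J)))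
        e∉K' : e ∉ K'
        e∉K' e∈K' = e∉W (p⊆p∪q (I ∩ J) (x∈p∩q⁺ (e∈J , e∈K')))
        I⊆E─K' : I ⊆ E ─ K'
        I⊆E─K' x∈I = x∈p∧x∉q⇒x∈p─q (p─q⊆p E B₁ (I⊆ x∈I)) (λ x∈K' → K'#I x∈K' x∈I)
        e∈E─K' : e ∈ E ─ K'
        e∈E─K' = x∈p∧x∉q⇒x∈p─q (p─q⊆p E B₂ (J⊆ e∈J)) e∉K'
    in e , e∈J , e∉I , coindep⁺ (I ∪ ⁅ e ⁆) bK' (∪-least I⊆E─K' (⁅⁆⊆ e∈E─K'))

  coindep-augment : ∀ I J → M*.indep I ≡ true → M*.indep J ≡ true → ∣ I ∣ < ∣ J ∣ →
    ∃[ e ] (e ∈ J × e ∉ I × M*.indep (I ∪ ⁅ e ⁆) ≡ true)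
  coindep-augment I J cI cJ ∣I∣<∣J∣ =
    let B₁ , bB₁ , I⊆ = coindep⁻ I cI
        B₂ , bB₂ , J⊆ = coindep⁻ J cJ
    in augmentFromBases bB₁ bB₂ I⊆ J⊆ ∣I∣<∣J∣

  isMatroid : IsMatroid (dual M)
  isMatroid = record
    { indep⊆E    = λ I h → ⊆-trans (proj₂ (proj₂ (coindep⁻ I h))) (p─q⊆p E _)
    ; indep-∅    = coindep-∅
    ; hereditary = hereditary*
    ; augment    = coindep-augment }
    where
    hereditary* : ∀ I J → J ⊆ I → M*.indep I ≡ true → M*.indep J ≡ true
    hereditary* I J J⊆I h = let _ , bB , I⊆ = coindep⁻ I h in coindep⁺ J bB (⊆-trans J⊆I I⊆)

  rank-dual : ∀ {X} → X ⊆ E → rank (dual M) X + fullRank ≡ ∣ X ∣ + rank M (E ─ X)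
  rank-dual {X} X⊆E = ≤-antisym rank*≤ rank*≥
    where
    open ≤-Reasoning
    -- a coindependent I ⊆ X avoids a base B, and B ─ X is independent in E ─ X
    rank*≤ : rank (dual M) X + fullRank ≤ ∣ X ∣ + rank M (E ─ X)
    rank*≤ =
      let I , cI , I⊆X , ∣I∣≡r* = M*F.rank-attained coindep-∅ X
          B , (iB , ∣B∣≡r) , I⊆E─B = coindep⁻ I cI
          I⊆X─B : I ⊆ X ─ B
          I⊆X─B x∈I = x∈p∧x∉q⇒x∈p─q (I⊆X x∈I) (⊆─⇒Disjoint I⊆E─B x∈I)
          B─X⊆E─X : B ─ X ⊆ E ─ X
          B─X⊆E─X x∈ = x∈p∧x∉q⇒x∈p─q (indep⊆E B iB (p─q⊆p B X x∈)) (x∈p─q⇒x∉q B X x∈)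
      in begin
      rank (dual M) X + fullRank    ≡⟨ cong₂ _+_ (sym ∣I∣≡r*) (sym ∣B∣≡r) ⟩
      ∣ I ∣ + ∣ B ∣                              ≡⟨ cong (∣ I ∣ +_) (∣p∣≡∣p∩q∣+∣p─q∣ B X) ⟩
      ∣ I ∣ + (∣ B ∩ X ∣ + ∣ B ─ X ∣)             ≤⟨ +-mono-≤ (p⊆q⇒∣p∣≤∣q∣ I⊆X─B) (+-monoʳ-≤ ∣ B ∩ X ∣
                                                    (rank-ub {B = B ─ X} (hereditary B (B ─ X) (p─q⊆p B X) iB) B─X⊆E─X)) ⟩
      ∣ X ─ B ∣ + (∣ B ∩ X ∣ + rank M (E ─ X))   ≡⟨ sym (+-assoc ∣ X ─ B ∣ _ _) ⟩
      ∣ X ─ B ∣ + ∣ B ∩ X ∣ + rank M (E ─ X)     ≡⟨ cong (_+ rank M (E ─ X)) (sym (∣p∣≡∣p─q∣+∣q∩p∣ X B)) ⟩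
      ∣ X ∣ + rank M (E ─ X)                    ∎
    -- a largest independent B₀ ⊆ E ─ X extends to a base B, and X ─ B is coindependent
    rank*≥ : ∣ X ∣ + rank M (E ─ X) ≤ rank (dual M) X + fullRank
    rank*≥ =
      let B₀ , iB₀ , B₀⊆E─X , ∣B₀∣≡r = rank-attainedᴹ (E ─ X)
          B , bB , B₀⊆B , _ = extendToBase iB₀ (proj₂ base-exists)
          X─B⊆E─B : X ─ B ⊆ E ─ B
          X─B⊆E─B x∈ = x∈p∧x∉q⇒x∈p─q (X⊆E (p─q⊆p X B x∈)) (x∈p─q⇒x∉q X B x∈)
          B₀⊆B─X : B₀ ⊆ B ─ X
          B₀⊆B─X x∈ = x∈p∧x∉q⇒x∈p─q (B₀⊆B x∈) (x∈p─q⇒x∉q E X (B₀⊆E─X x∈))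
      in begin
      ∣ X ∣ + rank M (E ─ X)             ≡⟨ cong₂ _+_ (∣p∣≡∣p─q∣+∣q∩p∣ X B) (sym ∣B₀∣≡r) ⟩
      ∣ X ─ B ∣ + ∣ B ∩ X ∣ + ∣ B₀ ∣       ≡⟨ +-assoc ∣ X ─ B ∣ _ _ ⟩
      ∣ X ─ B ∣ + (∣ B ∩ X ∣ + ∣ B₀ ∣)     ≤⟨ +-mono-≤ (M*F.rank-ub {B = X ─ B} (coindep⁺ (X ─ B) bB X─B⊆E─B) (p─q⊆p X B))
                                            (+-monoʳ-≤ ∣ B ∩ X ∣ (p⊆q⇒∣p∣≤∣q∣ B₀⊆B─X)) ⟩
      rank (dual M) X + (∣ B ∩ X ∣ + ∣ B ─ X ∣) ≡⟨ cong (rank (dual M) X +_) (sym (∣p∣≡∣p∩q∣+∣p─q∣ B X)) ⟩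
      rank (dual M) X + ∣ B ∣             ≡⟨ cong (rank (dual M) X +_) (proj₂ bB) ⟩
      rank (dual M) X + fullRank         ∎

module Minors (M : RawMatroid) (mat : IsMatroid M) {A : Subset (RawMatroid.size M)}
              (A⊆E : A ⊆ RawMatroid.E M) where
  open RawMatroid M
  open FiniteSubsets
  open ≡ using (sym; trans; cong; subst)
  open import Data.Nat using (_+_)
  open import Data.Nat.Properties using (+-comm; +-assoc; +-cancelˡ-≡; +-identityʳ; n≤0⇒n≡0)
  open import Data.Bool.Properties using (∧-identityʳ)

  restrict-isMatroid : IsMatroid (restrict M A)
  restrict-isMatroid = Deletion.isMatroid M mat (E ─ A)

  restrict-E : RawMatroid.E (restrict M A) ≡ A
  restrict-E = p─[p─q]≡q A⊆E

  restrict-rank : rank (restrict M A) (RawMatroid.E (restrict M A)) ≡ rank M A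
  restrict-rank = trans (Deletion.rankᴰ≡rank M mat (E ─ A) ⊆-refl) (cong (rank M) restrict-E)

  restrict-indep-E : RawMatroid.indep (restrict M A) (RawMatroid.E (restrict M A)) ≡ indep A
  restrict-indep-E = trans (cong (λ Z → indep Z ∧ (Z ⊆ᵇ Z)) restrict-E)
                           (trans (cong (indep A ∧_) (⊆⇒⊆ᵇ {p = A} ⊆-refl)) (∧-identityʳ (indep A)))

  private
    M*-isMatroid : IsMatroid (dual M)
    M*-isMatroid = Duality.isMatroid M mat

    N : RawMatroid
    N = delete (dual M) A

    N-isMatroid : IsMatroid N
    N-isMatroid = Deletion.isMatroid (dual M) M*-isMatroid A

  contract-isMatroid : IsMatroid (contract M A)
  contract-isMatroid = Duality.isMatroid N N-isMatroid

  contract-size : ∣ E ─ A ∣ + ∣ A ∣ ≡ ∣ E ∣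
  contract-size = ∣p─q∣+∣q∣≡∣p∣ A⊆E

  -- r_{M/A}(E ─ A) + r(A) = r(E), from the dual rank formula for M and for N
  contract-rank : rank (contract M A) (E ─ A) + rank M A ≡ rank M E
  contract-rank = sym (+-cancelˡ-≡ d _ _ (begin
    d + rank M E        ≡⟨ dualRankM ⟩
    k + rank M A        ≡⟨ cong (_+ rank M A) (sym c+d≡k) ⟩
    c + d + rank M A    ≡⟨ cong (_+ rank M A) (+-comm c d) ⟩
    d + c + rank M A    ≡⟨ +-assoc d c _ ⟩
    d + (c + rank M A)  ∎))
    where
    open ≡.≡-Reasoning
    c d k : ℕ
    c = rank (contract M A) (E ─ A)
    d = rank (dual M) (E ─ A)
    k = ∣ E ─ A ∣
    dualRankM : d + rank M E ≡ k + rank M A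
    dualRankM = trans (Duality.rank-dual M mat (p─q⊆p E A)) (cong (λ Z → k + rank M Z) restrict-E)
    emptyRank : rank N ((E ─ A) ─ (E ─ A)) ≡ 0
    emptyRank = n≤0⇒n≡0 (subst (rank N ((E ─ A) ─ (E ─ A)) ≤_) (∣p─p∣≡0 (E ─ A))
                                (MatroidTheory.rank≤card N N-isMatroid _))
    c+d≡k : c + d ≡ k
    c+d≡k = begin
      c + d                           ≡⟨ cong (c +_) (sym (Deletion.rankᴰ≡rank (dual M) M*-isMatroid A ⊆-refl)) ⟩
      c + rank N (E ─ A)              ≡⟨ Duality.rank-dual N N-isMatroid ⊆-refl ⟩
      k + rank N ((E ─ A) ─ (E ─ A))  ≡⟨ cong (k +_) emptyRank ⟩
      k + 0                           ≡⟨ +-identityʳ k ⟩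
      k                               ∎

module PolynomialFacts {c ℓ} (F : Field c ℓ) where
  open FieldOps F
  open PolyRing F
  open Polynomials F public
  module P = CommutativeSemiring polynomialSemiring
  private
    module K = CommutativeRing commutativeRing
  open import Relation.Binary.Reasoning.Setoid P.setoid
  open import Algebra.Properties.CommutativeSemigroup P.*-commutativeSemigroup using (x∙yz≈y∙xz)
  open import Algebra.Properties.Semiring.Mult K.semiring using (×1-homo-*) renaming (_×_ to _×ₙ_)
  open import Data.Nat using (_!; _≡ᵇ_; _<_) renaming (_*_ to _*ℕ_)
  open import Data.Nat.Properties using (≡ᵇ⇒≡; ≡⇒≡ᵇ)
  open import Data.List using (_++_; upTo; [_])
  open import Data.List.Properties using (map-++; map-cong; upTo-∷ʳ)
  open import Data.List.Membership.Propositional.Properties using (∈-upTo⁻)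
  open import Relation.Binary.PropositionalEquality using (_≢_)

  natK≡n×1 : ∀ n → natK n ≡ n ×ₙ 1#
  natK≡n×1 zero    = ≡.refl
  natK≡n×1 (suc n) = ≡.cong (1# +_) (natK≡n×1 n)

  natK-* : ∀ m n → natK (m *ℕ n) ≈ natK m * natK n
  natK-* m n = K.trans (K.reflexive (natK≡n×1 (m *ℕ n)))
    (K.trans (×1-homo-* m n) (K.sym (K.*-cong (K.reflexive (natK≡n×1 m)) (K.reflexive (natK≡n×1 n)))))

  scale-cong : ∀ {x y p q} → x ≈ y → p ≈P q → scale x p ≈P scale y q
  scale-cong x≈y p≈q a b d = K.*-cong x≈y (p≈q a b d)

  scale-scale : ∀ x y p → scale x (scale y p) ≈P scale (x * y) p
  scale-scale x y p a b d = K.sym (K.*-assoc x y _)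

  scale-1 : ∀ p → scale 1# p ≈P p
  scale-1 p a b d = K.*-identityˡ _

  scale-0P : ∀ x → scale x 0P ≈P 0P
  scale-0P x = P.trans (scale-cong K.refl 0P≈zero) (λ a b d → K.trans (K.zeroʳ x) (K.sym (0P≈zero a b d)))

  scale-natK-suc : ∀ n p → scale (natK (suc n)) p ≈P p +P scale (natK n) p
  scale-natK-suc n p a b d = K.trans (K.distribʳ _ _ _) (K.+-congʳ (K.*-identityˡ _))

  scale-natK-0 : ∀ p → scale (natK 0) p ≈P 0P
  scale-natK-0 p a b d = K.trans (K.zeroˡ _) (K.sym (0P≈zero a b d))

  *P-scale : ∀ x p q → p *P scale x q ≈P scale x (p *P q)
  *P-scale x p q = begin
    p *P scale x q          ≈⟨ P.*-congˡ (P.sym (constP*P x q)) ⟩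
    p *P (constP x *P q)    ≈⟨ x∙yz≈y∙xz p (constP x) q ⟩
    constP x *P (p *P q)    ≈⟨ constP*P x (p *P q) ⟩
    scale x (p *P q)        ∎

  when : Bool → Pol → Pol
  when t p = if t then p else 0P

  when-*ˡ : ∀ t p q → when t p *P q ≈P when t (p *P q)
  when-*ˡ true  p q = P.refl
  when-*ˡ false p q = P.zeroˡ q

  *P-whenʳ : ∀ t p q → p *P when t q ≈P when t (p *P q)
  *P-whenʳ true  p q = P.refl
  *P-whenʳ false p q = P.zeroʳ p

  scale-when : ∀ x t p → scale x (when t p) ≈P when t (scale x p)
  scale-when x true  p = P.refl
  scale-when x false p = scale-0P x

  ΣP-++ : ∀ ps qs → ΣP (ps ++ qs) ≈P ΣP ps +P ΣP qs
  ΣP-++ []       qs = P.sym (P.+-identityˡ (ΣP qs))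
  ΣP-++ (p ∷ ps) qs = P.trans (P.+-congˡ (ΣP-++ ps qs)) (P.sym (P.+-assoc p (ΣP ps) (ΣP qs)))

  ΣP-*ˡ : ∀ {A : Set} p (g : A → Pol) xs → p *P ΣP (map g xs) ≈P ΣP (map (λ x → p *P g x) xs)
  ΣP-*ˡ p g []       = P.zeroʳ p
  ΣP-*ˡ p g (x ∷ xs) = P.trans (P.distribˡ p (g x) (ΣP (map g xs))) (P.+-congˡ (ΣP-*ˡ p g xs))

  ΣP-when : ∀ {A : Set} t (g : A → Pol) xs → ΣP (map (λ x → when t (g x)) xs) ≈P when t (ΣP (map g xs))
  ΣP-when true  g xs       = P.refl
  ΣP-when false g []       = P.refl
  ΣP-when false g (x ∷ xs) = P.trans (P.+-congˡ (ΣP-when false g xs)) (P.+-identityˡ 0P)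

  ΣP-filter : ∀ {A : Set} (t : A → Bool) (g : A → Pol) xs →
    ΣP (map g (filterᵇ t xs)) ≈P ΣP (map (λ x → when (t x) (g x)) xs)
  ΣP-filter t g [] = P.refl
  ΣP-filter t g (x ∷ xs) with t x
  ... | true  = P.+-congˡ (ΣP-filter t g xs)
  ... | false = P.sym (P.trans (P.+-identityˡ _) (P.sym (ΣP-filter t g xs)))

  ΣP-filter-cong : ∀ {A : Set} (t : A → Bool) {g h : A → Pol} xs → (∀ x → t x ≡ true → g x ≈P h x) →
    ΣP (map g (filterᵇ t xs)) ≈P ΣP (map h (filterᵇ t xs))
  ΣP-filter-cong t []       g≈h = P.refl
  ΣP-filter-cong t (x ∷ xs) g≈h with t x in tx
  ... | true  = P.+-cong (g≈h x tx) (ΣP-filter-cong t xs g≈h)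
  ... | false = ΣP-filter-cong t xs g≈h

  -- Σ_{A ⊆ E} g A; sumSubsets M g of Defs is ΣSub (E of M) g
  ΣSub : ∀ {n} → Subset n → (Subset n → Pol) → Pol
  ΣSub {n} E g = ΣP (map g (filterᵇ (_⊆ᵇ E) (subsets n)))

  ΣSub-cong : ∀ {n} (E : Subset n) {g h} → (∀ A → A ⊆ E → g A ≈P h A) → ΣSub E g ≈P ΣSub E h
  ΣSub-cong {n} E g≈h = ΣP-filter-cong (_⊆ᵇ E) (subsets n) (λ A A⊆ᵇE → g≈h A (FiniteSubsets.⊆ᵇ⇒⊆ A⊆ᵇE))

  ΣSub-*ˡ : ∀ {n} (E : Subset n) p g → p *P ΣSub E g ≈P ΣSub E (λ A → p *P g A)
  ΣSub-*ˡ {n} E p g = ΣP-*ˡ p g (filterᵇ (_⊆ᵇ E) (subsets n))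

  ΣSub-∷ : ∀ {n} b (E : Subset n) g →
    ΣSub (b ∷ E) g ≈P ΣSub E (λ A → g (outside ∷ A)) +P when b (ΣSub E (λ A → g (inside ∷ A)))
  ΣSub-∷ {n} b E g = begin
    ΣSub (b ∷ E) g
      ≈⟨ ΣP-filter (_⊆ᵇ (b ∷ E)) g (subsets (suc n)) ⟩
    ΣP (map h (map (outside ∷_) ss ++ map (inside ∷_) ss))
      ≡⟨ ≡.cong ΣP (map-++ h (map (outside ∷_) ss) _) ⟩
    ΣP (map h (map (outside ∷_) ss) ++ map h (map (inside ∷_) ss))
      ≈⟨ ΣP-++ (map h (map (outside ∷_) ss)) _ ⟩
    ΣP (map h (map (outside ∷_) ss)) +P ΣP (map h (map (inside ∷_) ss))
      ≡⟨ ≡.cong₂ (λ xs ys → ΣP xs +P ΣP ys) (≡.sym (map-∘ ss))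
                 (≡.trans (≡.sym (map-∘ ss)) (map-cong (λ A → when-∧ b (A ⊆ᵇ E)) ss)) ⟩
    ΣP (map (λ A → when (A ⊆ᵇ E) (g (outside ∷ A))) ss) +P
    ΣP (map (λ A → when b (when (A ⊆ᵇ E) (g (inside ∷ A)))) ss)
      ≈⟨ P.+-cong (P.sym (ΣP-filter (_⊆ᵇ E) _ ss))
                  (P.trans (ΣP-when b _ ss) (when-cong b (P.sym (ΣP-filter (_⊆ᵇ E) _ ss)))) ⟩
    ΣSub E (λ A → g (outside ∷ A)) +P when b (ΣSub E (λ A → g (inside ∷ A))) ∎
    where
    ss = subsets n
    h : Subset (suc n) → Pol
    h A = when (A ⊆ᵇ (b ∷ E)) (g A)
    when-∧ : ∀ t u {p} → when (t ∧ u) p ≡ when t (when u p)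
    when-∧ true  u = ≡.refl
    when-∧ false u = ≡.refl
    when-cong : ∀ t {p q} → p ≈P q → when t p ≈P when t q
    when-cong true  p≈q = p≈q
    when-cong false p≈q = P.refl

  -- the only subset without elements is ∅
  ΣSub-card0 : ∀ {n} (E : Subset n) C → ΣSub E (λ A → when (∣ A ∣ ≡ᵇ 0) C) ≈P C
  ΣSub-card0 []      C = P.+-identityʳ C
  ΣSub-card0 (b ∷ E) C = begin
    ΣSub (b ∷ E) (λ A → when (∣ A ∣ ≡ᵇ 0) C)                  ≈⟨ ΣSub-∷ b E _ ⟩
    ΣSub E (λ A → when (∣ A ∣ ≡ᵇ 0) C) +P when b (ΣSub E (λ _ → 0P))
      ≈⟨ P.+-cong (ΣSub-card0 E C) (when-zero b (ΣP-when false (λ _ → C) (filterᵇ (_⊆ᵇ E) (subsets _)))) ⟩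
    C +P 0P                                                   ≈⟨ P.+-identityʳ C ⟩
    C                                                         ∎
    where
    when-zero : ∀ t {p} → p ≈P 0P → when t p ≈P 0P
    when-zero true  p≈0 = p≈0
    when-zero false p≈0 = P.refl

  -- a set E has |E| one-element subsets
  ΣSub-card1 : ∀ {n} (E : Subset n) C → ΣSub E (λ A → when (∣ A ∣ ≡ᵇ 1) C) ≈P scale (natK ∣ E ∣) C
  ΣSub-card1 []            C = P.trans (P.+-identityʳ 0P) (P.sym (scale-natK-0 C))
  ΣSub-card1 (outside ∷ E) C = P.trans (ΣSub-∷ outside E _) (P.trans (P.+-identityʳ _) (ΣSub-card1 E C))
  ΣSub-card1 (inside ∷ E)  C = begin
    ΣSub (inside ∷ E) (λ A → when (∣ A ∣ ≡ᵇ 1) C)             ≈⟨ ΣSub-∷ inside E _ ⟩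
    ΣSub E (λ A → when (∣ A ∣ ≡ᵇ 1) C) +P ΣSub E (λ A → when (∣ A ∣ ≡ᵇ 0) C)
      ≈⟨ P.+-cong (ΣSub-card1 E C) (ΣSub-card0 E C) ⟩
    scale (natK ∣ E ∣) C +P C                                 ≈⟨ P.+-comm _ C ⟩
    C +P scale (natK ∣ E ∣) C                                 ≈⟨ P.sym (scale-natK-suc ∣ E ∣ C) ⟩
    scale (natK (suc ∣ E ∣)) C                                ∎

  when-under : ∀ t {p q} → (t ≡ true → p ≈P q) → when t p ≈P when t q
  when-under true  p≈q = p≈q ≡.refl
  when-under false p≈q = P.refl

  when-≡ᵇ-refl : ∀ n p → when (n ≡ᵇ n) p ≡ p
  when-≡ᵇ-refl n p rewrite ListReading.T⇒≡ (≡⇒≡ᵇ n n ≡.refl) = ≡.refl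

  when-≡ᵇ-≢ : ∀ {m n} p → m ≢ n → when (m ≡ᵇ n) p ≈P 0P
  when-≡ᵇ-≢ {m} {n} p m≢n with m ≡ᵇ n in m≡ᵇn
  ... | true  = contradiction (≡ᵇ⇒≡ m n (ListReading.≡⇒T m≡ᵇn)) m≢n
  ... | false = P.refl

  ΣP-upTo-last : ∀ (g : ℕ → Pol) n → (∀ i → i < n → g i ≈P 0P) → ΣP (map g (upTo (suc n))) ≈P g n
  ΣP-upTo-last g n g<n≈0 = begin
    ΣP (map g (upTo (suc n)))       ≡⟨ ≡.cong (ΣP ∘ map g) (≡.sym (upTo-∷ʳ n)) ⟩
    ΣP (map g (upTo n ++ [ n ]))    ≡⟨ ≡.cong ΣP (map-++ g (upTo n) [ n ]) ⟩
    ΣP (map g (upTo n) ++ [ g n ])  ≈⟨ ΣP-++ (map g (upTo n)) [ g n ] ⟩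
    ΣP (map g (upTo n)) +P (g n +P 0P) ≈⟨ P.+-cong (ΣP-zero (upTo n) (λ i∈ → g<n≈0 _ (∈-upTo⁻ i∈))) (P.+-identityʳ (g n)) ⟩
    0P +P g n                       ≈⟨ P.+-identityˡ (g n) ⟩
    g n                             ∎
    where
    ΣP-zero : ∀ xs → (∀ {i} → i ∈L xs → g i ≈P 0P) → ΣP (map g xs) ≈P 0P
    ΣP-zero []       _    = P.refl
    ΣP-zero (x ∷ xs) xs≈0 = P.trans (P.+-cong (xs≈0 (Any.here ≡.refl)) (ΣP-zero xs (xs≈0 ∘ Any.there))) (P.+-identityˡ 0P)

  factorial-step : ∀ k n Q → scale (natK n) (when (suc k ≡ᵇ n) (scale (natK (k !)) Q))
                            ≈P when (suc k ≡ᵇ n) (scale (natK (suc k !)) Q)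
  factorial-step k n Q = P.trans (scale-when (natK n) (suc k ≡ᵇ n) (scale (natK (k !)) Q)) (when-under (suc k ≡ᵇ n) λ eq →
    ≡.subst (λ n → scale (natK n) (scale (natK (k !)) Q) ≈P scale (natK (suc k !)) Q)
            (≡ᵇ⇒≡ (suc k) n (ListReading.≡⇒T eq))
            (P.trans (scale-scale _ _ Q) (scale-cong (K.sym (natK-* (suc k) (k !))) P.refl)))

module PointCharacters {c ℓ} (F : Field c ℓ) (char0 : CharZero F) where
  open FieldOps F
  open PolyRing F
  open Convolution F char0
  open PolynomialFacts F
  private
    module K = CommutativeRing commutativeRing
  open import Data.Nat using (_!; _≡ᵇ_; _<_) renaming (_+_ to _+ℕ_)
  open import Data.Nat.Properties using (+-comm; +-identityʳ; +-∸-assoc; n≤0⇒n≡0; ≡ᵇ⇒≡; <⇒≢)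
  open import Relation.Binary.Reasoning.Setoid P.setoid
  open import Algebra.Properties.CommutativeSemigroup P.*-commutativeSemigroup using (x∙yz≈y∙xz)

  SupportedOnPoints : Fun → Pol → Pol → Set ℓ
  SupportedOnPoints δ a b = ∀ N →
    δ N ≈P when (∣ RawMatroid.E N ∣ ≡ᵇ 1) (if RawMatroid.indep N (RawMatroid.E N) then a else b)

  module _ {δ : Fun} {a b : Pol} (δ-points : SupportedOnPoints δ a b) where

    ab : ℕ → ℕ → Pol
    ab i j = a ^P i *P b ^P j

    abRank : RawMatroid → Pol
    abRank N = ab (rank N E) (∣ E ∣ ∸ rank N E)
      where open RawMatroid N

    -- adding a point: a coloop raises the rank, a loop the nullity
    point-step : ∀ v {i m r} → i ≤ m → i +ℕ (if v then 1 else 0) ≡ r →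
      (if v then a else b) *P ab i (m ∸ i) ≈P ab r (suc m ∸ r)
    point-step true  {i} {m} i≤m ≡.refl rewrite +-comm i 1 = P.sym (P.*-assoc a (a ^P i) (b ^P (m ∸ i)))
    point-step false {i} {m} i≤m ≡.refl rewrite +-identityʳ i | +-∸-assoc 1 i≤m =
      x∙yz≈y∙xz b (a ^P i) (b ^P (m ∸ i))

    power : ∀ k N → IsMatroid N →
      (δ ^⋆ k) N ≈P when (k ≡ᵇ ∣ RawMatroid.E N ∣) (scale (natK (k !)) (abRank N))
    power zero N matN with ∣ RawMatroid.E N ∣ in ∣E∣≡
    ... | suc _ = P.refl
    ... | zero  = P.sym (begin
      scale (1# + 0#) (ab (rank N E) (0 ∸ rank N E)) ≈⟨ scale-cong (K.+-identityʳ 1#) P.refl ⟩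
      scale 1# (ab (rank N E) (0 ∸ rank N E))        ≈⟨ scale-1 _ ⟩
      ab (rank N E) (0 ∸ rank N E)                   ≡⟨ ≡.cong (λ r → ab r (0 ∸ r)) rank≡0 ⟩
      1P *P 1P                                       ≈⟨ P.*-identityˡ 1P ⟩
      1P                                             ∎)
      where
      open RawMatroid N
      rank≡0 : rank N E ≡ 0
      rank≡0 = n≤0⇒n≡0 (≡.subst (rank N E ≤_) ∣E∣≡ (MatroidTheory.rank≤card N matN E))
    power (suc k) N matN = begin
      (δ ^⋆ suc k) N                                ≈⟨ ΣSub-cong E term ⟩
      ΣSub E (λ A → when (∣ A ∣ ≡ᵇ 1) C)            ≈⟨ ΣSub-card1 E C ⟩
      scale (natK ∣ E ∣) C                          ≈⟨ factorial-step k ∣ E ∣ (abRank N) ⟩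
      when (suc k ≡ᵇ ∣ E ∣) (scale (natK (suc k !)) (abRank N)) ∎
      where
      open RawMatroid N
      C : Pol
      C = when (suc k ≡ᵇ ∣ E ∣) (scale (natK (k !)) (abRank N))
      value : Subset size → Pol
      value A = if indep A then a else b
      term : ∀ A → A ⊆ E → δ (restrict N A) *P (δ ^⋆ k) (contract N A) ≈P when (∣ A ∣ ≡ᵇ 1) C
      term A A⊆E = begin
        δ (restrict N A) *P (δ ^⋆ k) (contract N A)
          ≈⟨ P.*-cong restricted (power k (contract N A) contract-isMatroid) ⟩
        when (∣ A ∣ ≡ᵇ 1) (value A) *P when (k ≡ᵇ ∣ E ─ A ∣) (scale (natK (k !)) (abRank (contract N A)))
          ≈⟨ when-*ˡ (∣ A ∣ ≡ᵇ 1) (value A) (when (k ≡ᵇ ∣ E ─ A ∣) (scale (natK (k !)) (abRank (contract N A)))) ⟩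
        when (∣ A ∣ ≡ᵇ 1) (value A *P when (k ≡ᵇ ∣ E ─ A ∣) (scale (natK (k !)) (abRank (contract N A))))
          ≈⟨ when-under (∣ A ∣ ≡ᵇ 1) (λ eq → one-point (≡ᵇ⇒≡ ∣ A ∣ 1 (ListReading.≡⇒T eq))) ⟩
        when (∣ A ∣ ≡ᵇ 1) C ∎
        where
        open Minors N matN A⊆E
        restricted : δ (restrict N A) ≈P when (∣ A ∣ ≡ᵇ 1) (value A)
        restricted = P.trans (δ-points (restrict N A))
          (P.reflexive (≡.cong₂ (λ n v → when (n ≡ᵇ 1) (if v then a else b)) (≡.cong ∣_∣ restrict-E) restrict-indep-E))
        one-point : ∣ A ∣ ≡ 1 →
          value A *P when (k ≡ᵇ ∣ E ─ A ∣) (scale (natK (k !)) (abRank (contract N A))) ≈P C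
        one-point ∣A∣≡1 = begin
          value A *P when (k ≡ᵇ m) (scale (natK (k !)) (ab r' (m ∸ r')))
            ≈⟨ *P-whenʳ (k ≡ᵇ m) (value A) _ ⟩
          when (k ≡ᵇ m) (value A *P scale (natK (k !)) (ab r' (m ∸ r')))
            ≈⟨ when-under (k ≡ᵇ m) (λ _ → P.trans (*P-scale (natK (k !)) (value A) (ab r' (m ∸ r'))) (scale-cong K.refl
                 (point-step (indep A) (MatroidTheory.rank≤card (contract N A) contract-isMatroid (E ─ A))
                             (≡.trans (≡.cong (r' +ℕ_) (≡.sym (MatroidTheory.rank-point N matN ∣A∣≡1))) contract-rank)))) ⟩
          when (k ≡ᵇ m) (scale (natK (k !)) (ab (rank N E) (suc m ∸ rank N E)))
            ≡⟨ ≡.cong (λ n → when (suc k ≡ᵇ n) (scale (natK (k !)) (ab (rank N E) (n ∸ rank N E)))) 1+m≡∣E∣ ⟩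
          C ∎
          where
          m r' : ℕ
          m = ∣ E ─ A ∣
          r' = rank (contract N A) (E ─ A)
          1+m≡∣E∣ : suc m ≡ ∣ E ∣
          1+m≡∣E∣ = ≡.trans (+-comm 1 m) (≡.trans (≡.cong (m +ℕ_) (≡.sym ∣A∣≡1)) contract-size)

    -- exp_*(δ)(N) = a^{r(N)} b^{|E|-r(N)}: only the term j = |E| of the exponential survives
    exp-points : ∀ N → IsMatroid N → exp⋆ δ N ≈P abRank N
    exp-points N matN = begin
      exp⋆ δ N                                            ≈⟨ ΣP-upTo-last term n vanish ⟩
      constP (invFact n) *P (δ ^⋆ n) N                    ≈⟨ P.*-congˡ (P.trans (power n N matN)
                                                              (P.reflexive (when-≡ᵇ-refl n _))) ⟩
      constP (invFact n) *P scale (natK (n !)) (abRank N) ≈⟨ constP*P (invFact n) _ ⟩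
      scale (invFact n) (scale (natK (n !)) (abRank N))   ≈⟨ scale-scale (invFact n) _ _ ⟩
      scale (invFact n * natK (n !)) (abRank N)           ≈⟨ scale-cong invFact-inverse P.refl ⟩
      scale 1# (abRank N)                                 ≈⟨ scale-1 _ ⟩
      abRank N                                            ∎
      where
      n : ℕ
      n = ∣ RawMatroid.E N ∣
      term : ℕ → Pol
      term j = constP (invFact j) *P (δ ^⋆ j) N
      vanish : ∀ i → i < n → term i ≈P 0P
      vanish i i<n = P.trans (P.*-congˡ (P.trans (power i N matN) (when-≡ᵇ-≢ _ (<⇒≢ i<n))))
                             (P.zeroʳ (constP (invFact i)))
      invFact-inverse : invFact n * natK (n !) ≈ 1#
      invFact-inverse = K.trans (K.*-comm _ _) (inv-inverse _ _)

module TutteExpansion {c ℓ} (F : Field c ℓ) (char0 : CharZero F) where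
  open FieldOps F
  open PolyRing F
  open Convolution F char0
  open PolynomialFacts F
  open PointCharacters F char0
  open import Data.Nat using (_≡ᵇ_) renaming (_+_ to _+ℕ_)
  open import Data.Nat.Properties using (m+[n∸m]≡n; m+n∸n≡m)
  open import Relation.Binary.Reasoning.Setoid P.setoid
  open import Algebra.Properties.CommutativeSemiring.Exp polynomialSemiring using (_^_; ^-homo-*; ^-distrib-*)
  import Algebra.Solver.CommutativeMonoid P.*-commutativeMonoid as Solver

  X' Y' : Pol
  X' = X -P 1P
  Y' = Y -P 1P

  δ₁ δ₂ : Fun
  δ₁ = S ·F (δcoloop +F (Y' ·F δloop))
  δ₂ = S ·F ((X' ·F δcoloop) +F δloop)

  δ₁-points : SupportedOnPoints δ₁ S (S *P Y')
  δ₁-points N with ∣ RawMatroid.E N ∣ ≡ᵇ 1 | RawMatroid.indep N (RawMatroid.E N)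
  ... | true  | true  = P.trans (P.*-congˡ (P.trans (P.+-congˡ (P.zeroʳ Y')) (P.+-identityʳ 1P))) (P.*-identityʳ S)
  ... | true  | false = P.*-congˡ (P.trans (P.+-identityˡ (Y' *P 1P)) (P.*-identityʳ Y'))
  ... | false | _     = P.trans (P.*-congˡ (P.trans (P.+-identityˡ (Y' *P 0P)) (P.zeroʳ Y'))) (P.zeroʳ S)

  δ₂-points : SupportedOnPoints δ₂ (S *P X') S
  δ₂-points N with ∣ RawMatroid.E N ∣ ≡ᵇ 1 | RawMatroid.indep N (RawMatroid.E N)
  ... | true  | true  = P.*-congˡ (P.trans (P.+-identityʳ (X' *P 1P)) (P.*-identityʳ X'))
  ... | true  | false = P.trans (P.*-congˡ (P.trans (P.+-congʳ (P.zeroʳ X')) (P.+-identityˡ 1P))) (P.*-identityʳ S)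
  ... | false | _     = P.trans (P.*-congˡ (P.trans (P.+-identityʳ (X' *P 0P)) (P.zeroʳ X'))) (P.zeroʳ S)

  ^P≈^ : ∀ p n → p ^P n ≈P p ^ n
  ^P≈^ p zero    = P.refl
  ^P≈^ p (suc n) = P.*-congˡ (^P≈^ p n)

  collect-s : ∀ s x y u v w z →
    (s ^P u *P (s *P y) ^P v) *P ((s *P x) ^P w *P s ^P z) ≈P s ^P ((w +ℕ z) +ℕ (u +ℕ v)) *P (x ^P w *P y ^P v)
  collect-s s x y u v w z = begin
    (s ^P u *P (s *P y) ^P v) *P ((s *P x) ^P w *P s ^P z)
      ≈⟨ P.*-cong (P.*-cong (^P≈^ s u) (^P≈^ (s *P y) v)) (P.*-cong (^P≈^ (s *P x) w) (^P≈^ s z)) ⟩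
    (s ^ u *P (s *P y) ^ v) *P ((s *P x) ^ w *P s ^ z)
      ≈⟨ P.*-cong (P.*-cong (P.refl {s ^ u}) (^-distrib-* s y v)) (P.*-cong (^-distrib-* s x w) (P.refl {s ^ z})) ⟩
    (s ^ u *P (s ^ v *P y ^ v)) *P ((s ^ w *P x ^ w) *P s ^ z)
      ≈⟨ Solver.solve 6 (λ su sv yv sw xw sz →
           (su ⊕ (sv ⊕ yv)) ⊕ ((sw ⊕ xw) ⊕ sz) ⊜ ((sw ⊕ sz) ⊕ (su ⊕ sv)) ⊕ (xw ⊕ yv))
           P.refl (s ^ u) (s ^ v) (y ^ v) (s ^ w) (x ^ w) (s ^ z) ⟩
    ((s ^ w *P s ^ z) *P (s ^ u *P s ^ v)) *P (x ^ w *P y ^ v)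
      ≈⟨ P.*-cong (P.sym (P.trans (^-homo-* s (w +ℕ z) (u +ℕ v)) (P.*-cong (^-homo-* s w z) (^-homo-* s u v))))
                  (P.refl {x ^ w *P y ^ v}) ⟩
    s ^ ((w +ℕ z) +ℕ (u +ℕ v)) *P (x ^ w *P y ^ v)
      ≈⟨ P.sym (P.*-cong (^P≈^ s ((w +ℕ z) +ℕ (u +ℕ v))) (P.*-cong (^P≈^ x w) (^P≈^ y v))) ⟩
    s ^P ((w +ℕ z) +ℕ (u +ℕ v)) *P (x ^P w *P y ^P v) ∎
    where open Solver using (_⊕_; _⊜_)

  module _ (M : Matroid) where
    open Matroid M using (E; size)
    private
      Mr : RawMatroid
      Mr = Matroid.raw M
      mat : IsMatroid Mr
      mat = Matroid.isMatroid M

    tutteTerm : Subset size → Pol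
    tutteTerm A = (X' ^P (rank Mr E ∸ rank Mr A)) *P (Y' ^P (∣ A ∣ ∸ rank Mr A))

    α-term : ∀ A → A ⊆ E → exp⋆ δ₁ (restrict Mr A) *P exp⋆ δ₂ (contract Mr A) ≈P S ^P ∣ E ∣ *P tutteTerm A
    α-term A A⊆E = begin
      exp⋆ δ₁ (restrict Mr A) *P exp⋆ δ₂ (contract Mr A)
        ≈⟨ P.*-cong (P.trans (exp-points δ₁-points (restrict Mr A) restrict-isMatroid)
                             (P.reflexive (≡.cong₂ (λ r n → S ^P r *P (S *P Y') ^P (n ∸ r)) restrict-rank (≡.cong ∣_∣ restrict-E))))
                    (exp-points δ₂-points (contract Mr A) contract-isMatroid) ⟩
      (S ^P rA *P (S *P Y') ^P (∣ A ∣ ∸ rA)) *P ((S *P X') ^P r' *P S ^P (k ∸ r'))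
        ≈⟨ collect-s S X' Y' rA (∣ A ∣ ∸ rA) r' (k ∸ r') ⟩
      S ^P ((r' +ℕ (k ∸ r')) +ℕ (rA +ℕ (∣ A ∣ ∸ rA))) *P (X' ^P r' *P Y' ^P (∣ A ∣ ∸ rA))
        ≡⟨ ≡.cong₂ (λ e w → S ^P e *P (X' ^P w *P Y' ^P (∣ A ∣ ∸ rA))) total-degree (≡.sym corank) ⟩
      S ^P ∣ E ∣ *P tutteTerm A ∎
      where
      open Minors Mr mat A⊆E
      rA r' k : ℕ
      rA = rank Mr A
      r' = rank (contract Mr A) (E ─ A)
      k = ∣ E ─ A ∣
      total-degree : (r' +ℕ (k ∸ r')) +ℕ (rA +ℕ (∣ A ∣ ∸ rA)) ≡ ∣ E ∣
      total-degree = ≡.trans (≡.cong₂ _+ℕ_ (m+[n∸m]≡n (MatroidTheory.rank≤card (contract Mr A) contract-isMatroid (E ─ A)))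
                                           (m+[n∸m]≡n (MatroidTheory.rank≤card Mr mat A)))
                             contract-size
      corank : rank Mr E ∸ rA ≡ r'
      corank = ≡.trans (≡.cong (_∸ rA) (≡.sym contract-rank)) (m+n∸n≡m r' rA)

    theorem : α Mr ≈P S ^P ∣ E ∣ *P Tutte Mr
    theorem = begin
      α Mr                                  ≈⟨ ΣSub-cong E α-term ⟩
      ΣSub E (λ A → S ^P ∣ E ∣ *P tutteTerm A) ≈⟨ P.sym (ΣSub-*ˡ E (S ^P ∣ E ∣) tutteTerm) ⟩
      S ^P ∣ E ∣ *P Tutte Mr                  ∎

mainTheorem4 : ∀ {c ℓ} (F : Field c ℓ) (char0 : CharZero F) (M : Matroid) →
    let open PolyRing F
        open Convolution F char0
    in α (Matroid.raw M) ≈P (S ^P ∣ Matroid.E M ∣) *P Tutte (Matroid.raw M)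
mainTheorem4 F char0 M = TutteExpansion.theorem F char0 M
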